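{- Let $p$ be a prime and $N_p=\frac{p^p-1}{p-1}$. For all integers $n,k\geq 0$, $$A_{n+N_p+k,\,k}\equiv A_{n+k,k}\pmod p\qquad\text{and}\qquad A_{n+N_p+k,\,N_p+k}\equiv A_{n+k,k}\pmod p.$$ That is, the sequences $(A_{n+k,k})_{n\geq 0}$ (for fixed $k$) and $(A_{n+k,k})_{k\geq 0}$ (for fixed $n$) are both periodic modulo $p$ with period $N_p$.
   Context: A partition of a finite set is a collection of nonempty, pairwise disjoint subsets (blocks) whose union is the set; a singleton of a partition is a block with exactly one element. For integers $0\leq k\leq n$, $A_{n,k}$ denotes the number of partitions of $\{1,2,\dots,n+1\}$ whose largest singleton is $k+1$ (i.e. $\{k+1\}$ is a block and no $j>k+1$ forms a singleton block). -}

module Defs where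

open import Data.Bool using (Bool; true; false)
import Data.Bool.Properties as BoolP
open import Data.Nat using (ℕ; zero; suc; _∸_; _^_; _<_; _<?_)
open import Data.Nat.DivMod using (_/_)
open import Data.Fin using (Fin; toℕ)
open import Data.Fin.Subset using (Subset; Nonempty; Empty; _∩_; _∈_; ⁅_⁆)
open import Data.Fin.Subset.Properties using (nonempty?; _∈?_)
open import Data.Fin.Properties using (all?; any?)
open import Data.Vec using (Vec; []; _∷_)
import Data.Vec.Properties as VecP
open import Data.List using (List; []; _∷_; [_]; map; _++_; length; filter)
open import Data.List.Relation.Unary.All using (All) renaming (all? to allL?)
open import Data.List.Relation.Unary.Any using (Any) renaming (any? to anyL?)
open import Data.List.Relation.Unary.AllPairs using (AllPairs)
import Data.List.Relation.Unary.AllPairs as AP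
import Data.List.Membership.Propositional as Mem
import Data.List.Membership.DecPropositional as DecMem
open import Data.Product using (Σ; ∃; _×_; _,_)
open import Relation.Binary.PropositionalEquality using (_≡_)
open import Relation.Nullary using (Dec; yes; no; ¬_; ¬?; _×-dec_; _→-dec_)
open import Data.Nat using (_≟_)

allSubsets : (m : ℕ) → List (Subset m)
allSubsets zero    = [ [] ]
allSubsets (suc m) = map (true ∷_) (allSubsets m) ++ map (false ∷_) (allSubsets m)

-- all subsequences of a list; applied to a duplicate-free list this lists
-- every subfamily exactly once
sublists : ∀ {a} {A : Set a} → List A → List (List A)
sublists []       = [ [] ]
sublists (x ∷ xs) = map (x ∷_) (sublists xs) ++ sublists xs

record IsPartition {m : ℕ} (bs : List (Subset m)) : Set where
  field
    blocksNonempty   : All Nonempty bs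
    pairwiseDisjoint : AllPairs (λ b c → Empty (b ∩ c)) bs
    covers           : ∀ (i : Fin m) → Any (i ∈_) bs

LargestSingleton : {m : ℕ} → ℕ → List (Subset m) → Set
LargestSingleton {m} k bs =
  (∃ λ (j : Fin m) → toℕ j ≡ k × ⁅ j ⁆ Mem.∈ bs)
  × (∀ (j : Fin m) → k < toℕ j → ¬ (⁅ j ⁆ Mem.∈ bs))

_∈L?_ : ∀ {m} (b : Subset m) (bs : List (Subset m)) → Dec (b Mem.∈ bs)
_∈L?_ {m} b bs = DecMem._∈?_ (VecP.≡-dec {n = m} BoolP._≟_) b bs

empty? : ∀ {m} (p : Subset m) → Dec (Empty p)
empty? p = ¬? (nonempty? p)

isPartition? : ∀ {m} (bs : List (Subset m)) → Dec (IsPartition bs)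
isPartition? bs with allL? nonempty? bs | AP.allPairs? (λ b c → empty? (b ∩ c)) bs
                   | all? (λ i → anyL? (i ∈?_) bs)
... | yes a | yes d | yes c = yes (record { blocksNonempty = a ; pairwiseDisjoint = d ; covers = c })
... | no ¬a | _     | _     = no λ P → ¬a (IsPartition.blocksNonempty P)
... | yes _ | no ¬d | _     = no λ P → ¬d (IsPartition.pairwiseDisjoint P)
... | yes _ | yes _ | no ¬c = no λ P → ¬c (IsPartition.covers P)

largestSingleton? : ∀ {m} k (bs : List (Subset m)) → Dec (LargestSingleton k bs)
largestSingleton? k bs =
  any? (λ j → (toℕ j ≟ k) ×-dec (⁅ j ⁆ ∈L? bs))
  ×-dec all? (λ j → (k <? toℕ j) →-dec ¬? (⁅ j ⁆ ∈L? bs))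

-- A n k : number of partitions of {1,…,n+1} (encoded as Fin (suc n), element
-- i+1 ↦ index i) whose largest singleton is k+1 (index k).

A : ℕ → ℕ → ℕ
A n k = length (filter (λ bs → isPartition? bs ×-dec largestSingleton? k bs)
                       (sublists (allSubsets (suc n))))

-- N_p = (p^p - 1)/(p - 1)  (for p ≥ 2; junk value 0 otherwise)
Np : ℕ → ℕ
Np (suc (suc q)) = (suc (suc q) ^ suc (suc q) ∸ 1) / suc q
Np _             = 0

-- Write B for the Bell numbers, E for the shift (E a) k = a (k + 1) on integer sequences and
-- N = 1 + p + ⋯ + pᵖ⁻¹.  Counting partitions of {1, …, n + k + 1} with largest singleton k + 1
-- by inclusion–exclusion over the n larger elements, none of which may be a singleton, gives
-- A (n + k) k = ((E - 1)ⁿ B) k.  Modulo p the binomial theorem and Fermat give (E + c)ᵖ ≡ Eᵖ + c,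
-- and x (x + 1)⋯(x + p - 1) ≡ xᵖ - x.  Touchard's congruence B (p + k) ≡ B (k + 1) + B k says
-- that Eᵖ ≡ E + 1 on B and on all its differences; there (E + c)^(pʲ) ≡ E + c + j, hence
--   (E + c)ᴺ ≡ (E + c)(E + c + 1)⋯(E + c + p - 1) ≡ (E + c)ᵖ - (E + c) ≡ Eᵖ - E ≡ 1.
-- For c = 0 this is periodicity in k, for c = -1 periodicity in n.  Touchard's congruence comes
-- from the same product: by the Bell recurrence, β c i = ((E + c)ⁱ B) 0 satisfies
-- β (c + 1) = (E - c) (β c), so B = β 0 = (E + p)(E + p - 1)⋯(E + 1) (β (-p)) ≡ (Eᵖ - E) B.
module Submission where

open import Data.Nat.Base using (ℕ; suc)
open import Data.Nat.Primality using (Prime)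
open import Data.Integer.Base using (1ℤ)
open import Relation.Binary.PropositionalEquality using (_≡_)

module ShiftOperators where

  open import Data.Nat.Base as ℕ using (ℕ; zero; suc; _∸_; _<_; s≤s)
  import Data.Nat.Properties as ℕP
  open import Data.Nat.GeneralisedArithmetic using (iterate)
  open import Data.Nat.Combinatorics using (_C_; k>n⇒nCk≡0; nCk+nC[k+1]≡[n+1]C[k+1])
  open import Data.Integer.Base using (ℤ; +_; +0; _+_; _*_; _-_; -_; _^_)
  import Data.Integer.Properties as ℤP
  open import Data.Integer.Tactic.RingSolver using (solve-∀)
  open import Relation.Binary.Core using (Rel)
  open import Relation.Nullary using (Dec; yes; no)
  open import Relation.Binary.PropositionalEquality

  module _ {A : Set} (f : A → A) where

    iterate-+ : ∀ x m n → iterate f x (m ℕ.+ n) ≡ iterate f (iterate f x m) n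
    iterate-+ x zero    n = refl
    iterate-+ x (suc m) n = iterate-+ (f x) m n

    iterate-* : ∀ x m n → iterate f x (m ℕ.* n) ≡ iterate (λ y → iterate f y n) x m
    iterate-* x zero    n = refl
    iterate-* x (suc m) n = trans (iterate-+ x n (m ℕ.* n)) (iterate-* (iterate f x n) m n)

    iterate-preserves : ∀ {ℓ} (_∼_ : Rel A ℓ) → (∀ {x y} → x ∼ y → f x ∼ f y) →
                        ∀ n {x y} → x ∼ y → iterate f x n ∼ iterate f y n
    iterate-preserves _∼_ f-pres zero    x∼y = x∼y
    iterate-preserves _∼_ f-pres (suc n) x∼y = iterate-preserves _∼_ f-pres n (f-pres x∼y)

  Seq : Set
  Seq = ℕ → ℤ

  E+[_] : ℤ → Seq → Seq
  E+[ c ] a k = a (suc k) + c * a k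

  E+[_]^[_] : ℤ → ℕ → Seq → Seq
  E+[ c ]^[ n ] a = iterate E+[ c ] a n

  _⊕_ : Seq → Seq → Seq
  (a ⊕ b) k = a k + b k

  _⊙_ : ℤ → Seq → Seq
  (s ⊙ a) k = s * a k

  E+-cong : ∀ c {a b} → a ≗ b → E+[ c ] a ≗ E+[ c ] b
  E+-cong c a≗b k = cong₂ (λ x y → x + c * y) (a≗b (suc k)) (a≗b k)

  E+-⊕ : ∀ c a b → E+[ c ] (a ⊕ b) ≗ E+[ c ] a ⊕ E+[ c ] b
  E+-⊕ c a b k = distrib (a (suc k)) (b (suc k)) (a k) (b k) c
    where
    distrib : ∀ x y u v c → (x + y) + c * (u + v) ≡ (x + c * u) + (y + c * v)
    distrib = solve-∀

  E+-⊙ : ∀ c s a → E+[ c ] (s ⊙ a) ≗ s ⊙ E+[ c ] a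
  E+-⊙ c s a k = distrib (a (suc k)) (a k) c s
    where
    distrib : ∀ x y c s → s * x + c * (s * y) ≡ s * (x + c * y)
    distrib = solve-∀

  E+-comm : ∀ c d a → E+[ c ] (E+[ d ] a) ≗ E+[ d ] (E+[ c ] a)
  E+-comm c d a k = comm (a (suc (suc k))) (a (suc k)) (a k) c d
    where
    comm : ∀ x y z c d → (x + d * y) + c * (y + d * z) ≡ (x + c * y) + d * (y + c * z)
    comm = solve-∀

  E+^-cong : ∀ c n {a b} → a ≗ b → E+[ c ]^[ n ] a ≗ E+[ c ]^[ n ] b
  E+^-cong c = iterate-preserves E+[ c ] _≗_ (E+-cong c)

  E+^-⊕ : ∀ c n a b → E+[ c ]^[ n ] (a ⊕ b) ≗ E+[ c ]^[ n ] a ⊕ E+[ c ]^[ n ] b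
  E+^-⊕ c zero    a b k = refl
  E+^-⊕ c (suc n) a b k =
    trans (E+^-cong c n (E+-⊕ c a b) k) (E+^-⊕ c n (E+[ c ] a) (E+[ c ] b) k)

  E+^-⊙ : ∀ c n s a → E+[ c ]^[ n ] (s ⊙ a) ≗ s ⊙ E+[ c ]^[ n ] a
  E+^-⊙ c zero    s a k = refl
  E+^-⊙ c (suc n) s a k =
    trans (E+^-cong c n (E+-⊙ c s a) k) (E+^-⊙ c n s (E+[ c ] a) k)

  E+^-comm : ∀ c d n a → E+[ d ] (E+[ c ]^[ n ] a) ≗ E+[ c ]^[ n ] (E+[ d ] a)
  E+^-comm c d zero    a k = refl
  E+^-comm c d (suc n) a k =
    trans (E+^-comm c d n (E+[ c ] a) k) (E+^-cong c n (E+-comm d c a) k)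

  E+^-suc : ∀ c n a → E+[ c ]^[ suc n ] a ≗ E+[ c ] (E+[ c ]^[ n ] a)
  E+^-suc c n a k = sym (E+^-comm c c n a k)

  E+[0]^-shift : ∀ n a k → E+[ +0 ]^[ n ] a k ≡ a (n ℕ.+ k)
  E+[0]^-shift zero    a k = refl
  E+[0]^-shift (suc n) a k =
    trans (E+[0]^-shift n (E+[ +0 ] a) k) (ℤP.+-identityʳ (a (suc (n ℕ.+ k))))

  ∑< : ℕ → (ℕ → ℤ) → ℤ
  ∑< zero    f = +0
  ∑< (suc n) f = ∑< n f + f n

  ∑<-cong : ∀ n {f g} → (∀ i → f i ≡ g i) → ∑< n f ≡ ∑< n g
  ∑<-cong zero    f≗g = refl
  ∑<-cong (suc n) f≗g = cong₂ _+_ (∑<-cong n f≗g) (f≗g n)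

  ∑<-+ : ∀ n f g → ∑< n (λ i → f i + g i) ≡ ∑< n f + ∑< n g
  ∑<-+ zero    f g = refl
  ∑<-+ (suc n) f g = trans (cong (_+ (f n + g n)) (∑<-+ n f g)) (swap (∑< n f) (∑< n g) (f n) (g n))
    where
    swap : ∀ a b c d → (a + b) + (c + d) ≡ (a + c) + (b + d)
    swap = solve-∀

  ∑<-* : ∀ n s f → ∑< n (λ i → s * f i) ≡ s * ∑< n f
  ∑<-* zero    s f = sym (ℤP.*-zeroʳ s)
  ∑<-* (suc n) s f = trans (cong (_+ s * f n) (∑<-* n s f)) (sym (ℤP.*-distribˡ-+ s (∑< n f) (f n)))

  ∑<-head : ∀ n f → ∑< (suc n) f ≡ f 0 + ∑< n (λ i → f (suc i))
  ∑<-head zero    f = trans (ℤP.+-identityˡ (f 0)) (sym (ℤP.+-identityʳ (f 0)))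
  ∑<-head (suc n) f = trans (cong (_+ f (suc n)) (∑<-head n f)) (ℤP.+-assoc (f 0) _ _)

  ∑<-last-zero : ∀ n f → f n ≡ +0 → ∑< (suc n) f ≡ ∑< n f
  ∑<-last-zero n f fn≡0 = trans (cong (λ z → ∑< n f + z) fn≡0) (ℤP.+-identityʳ (∑< n f))

  -- Polynomials are coefficient sequences ℕ → ℤ; mul-X+[ c ] u is (X + c) · u.
  mul-X+[_] : ℤ → (ℕ → ℤ) → ℕ → ℤ
  mul-X+[ c ] u zero    = c * u zero
  mul-X+[ c ] u (suc i) = u i + c * u (suc i)

  mul-X+-cong : ∀ c {u v} → (∀ i → u i ≡ v i) → mul-X+[ c ] u ≗ mul-X+[ c ] v
  mul-X+-cong c u≗v zero    = cong (c *_) (u≗v zero)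
  mul-X+-cong c u≗v (suc i) = cong₂ (λ x y → x + c * y) (u≗v i) (u≗v (suc i))

  mul-X+-+ : ∀ c d u → mul-X+[ c ] u ⊕ (d ⊙ u) ≗ mul-X+[ c + d ] u
  mul-X+-+ c d u zero    = sym (ℤP.*-distribʳ-+ (u zero) c d)
  mul-X+-+ c d u (suc i) = collect (u i) (u (suc i)) c d
    where collect : ∀ x y c d → (x + c * y) + d * y ≡ x + (c + d) * y
          collect = solve-∀

  ∑<-distrib : ∀ n (u : ℕ → ℤ) c (x y : ℕ → ℤ) →
               ∑< n (λ i → u i * (x i + c * y i)) ≡ ∑< n (λ i → u i * x i) + c * ∑< n (λ i → u i * y i)
  ∑<-distrib n u c x y =
    trans (∑<-cong n (λ i → distrib (u i) c (x i) (y i)))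
          (trans (∑<-+ n (λ i → u i * x i) (λ i → c * (u i * y i)))
                 (cong (λ z → ∑< n (λ i → u i * x i) + z) (∑<-* n c (λ i → u i * y i))))
    where distrib : ∀ u c x y → u * (x + c * y) ≡ u * x + c * (u * y)
          distrib = solve-∀

  lincomb : ℕ → (ℕ → ℤ) → (ℕ → Seq) → Seq
  lincomb n u b k = ∑< (suc n) (λ i → u i * b i k)

  lincomb-cong : ∀ n {u v} → (∀ i → u i ≡ v i) → ∀ b → lincomb n u b ≗ lincomb n v b
  lincomb-cong n u≗v b k = ∑<-cong (suc n) (λ i → cong (_* b i k) (u≗v i))

  mul-X+-lincomb : ∀ c n u b → mul-X+[ c ] (lincomb n u b) ≗ lincomb n u (λ i → mul-X+[ c ] (b i))
  mul-X+-lincomb c n u b zero    =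
    sym (trans (∑<-cong (suc n) (λ i → comm (u i) c (b i zero))) (∑<-* (suc n) c _))
    where comm : ∀ u c x → u * (c * x) ≡ c * (u * x)
          comm = solve-∀
  mul-X+-lincomb c n u b (suc m) = sym (∑<-distrib (suc n) u c (λ i → b i m) (λ i → b i (suc m)))

  E+-lincomb : ∀ B n u b → E+[ B ] (lincomb n u b) ≗ lincomb n u (λ i → E+[ B ] (b i))
  E+-lincomb B n u b k = sym (∑<-distrib (suc n) u B (λ i → b i (suc k)) (λ i → b i k))

  -- When b i = Dⁱ b₀ for a linear operator D, lincomb n u b is u(D) b₀; this is multiplicative in u.
  module _ (D : Seq → Seq) (D-linear : ∀ n u b → D (lincomb n u b) ≗ lincomb n u (λ i → D (b i))) where

    lincomb-mul-X+ : ∀ c n u b → u (suc n) ≡ +0 → (∀ i → b (suc i) ≗ D (b i)) →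
                     lincomb (suc n) (mul-X+[ c ] u) b ≗ D (lincomb n u b) ⊕ (c ⊙ lincomb n u b)
    lincomb-mul-X+ c n u b top≡0 b-step k = begin
        ∑< (suc (suc n)) (λ i → mul-X+[ c ] u i * b i k)
      ≡⟨ ∑<-head (suc n) _ ⟩
        c * u 0 * b 0 k + ∑< (suc n) (λ i → (u i + c * u (suc i)) * b (suc i) k)
      ≡⟨ cong (λ z → c * u 0 * b 0 k + z) distribute ⟩
        c * u 0 * b 0 k + (S′ + c * T)
      ≡⟨ regroup c (u 0) (b 0 k) S′ T ⟩
        S′ + c * (u 0 * b 0 k + T)
      ≡⟨ cong₂ (λ x y → x + c * y) stepped drop-head ⟩
        D (lincomb n u b) k + c * lincomb n u b k
      ∎
      where
      open ≡-Reasoning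
      S′ T : ℤ
      S′ = ∑< (suc n) (λ i → u i * b (suc i) k)
      T  = ∑< (suc n) (λ i → u (suc i) * b (suc i) k)
      distribute : ∑< (suc n) (λ i → (u i + c * u (suc i)) * b (suc i) k) ≡ S′ + c * T
      distribute = trans (∑<-cong (suc n) (λ i → split (u i) c (u (suc i)) (b (suc i) k)))
                         (trans (∑<-+ (suc n) _ _) (cong (λ z → S′ + z) (∑<-* (suc n) c _)))
        where split : ∀ x c y d → (x + c * y) * d ≡ x * d + c * (y * d)
              split = solve-∀
      regroup : ∀ c x d s t → c * x * d + (s + c * t) ≡ s + c * (x * d + t)
      regroup = solve-∀
      stepped : S′ ≡ D (lincomb n u b) k
      stepped = trans (∑<-cong (suc n) (λ i → cong (u i *_) (b-step i k))) (sym (D-linear n u b k))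
      drop-head : u 0 * b 0 k + T ≡ lincomb n u b k
      drop-head = trans (sym (∑<-head (suc n) _))
                        (∑<-last-zero (suc n) _ (trans (cong (_* b (suc n) k) top≡0) (ℤP.*-zeroˡ (b (suc n) k))))

  -- u(E + B) a, for a polynomial u of degree at most n
  evalE+[_] : ℤ → ℕ → (ℕ → ℤ) → Seq → Seq
  evalE+[ B ] n u a = lincomb n u (λ i → E+[ B ]^[ i ] a)

  evalE+-mul-X+ : ∀ B c n u a → u (suc n) ≡ +0 →
                  evalE+[ B ] (suc n) (mul-X+[ c ] u) a ≗ E+[ B + c ] (evalE+[ B ] n u a)
  evalE+-mul-X+ B c n u a top≡0 k =
    trans (lincomb-mul-X+ E+[ B ] (E+-lincomb B) c n u (λ i → E+[ B ]^[ i ] a) top≡0 (λ i → E+^-suc B i a) k)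
          (collect (S (suc k)) (S k) B c)
    where
    S = evalE+[ B ] n u a
    collect : ∀ x y B c → (x + B * y) + c * y ≡ x + (B + c) * y
    collect = solve-∀

  -- coefficients of u(X + 1), for a polynomial u of degree at most n
  translate : ℕ → (ℕ → ℤ) → ℕ → ℤ
  translate n u = lincomb n u (λ i m → + (i C m))

  C-pascal : ∀ i → (λ m → + (suc i C m)) ≗ mul-X+[ + 1 ] (λ m → + (i C m))
  C-pascal i zero    = refl
  C-pascal i (suc m) =
    trans (cong +_ (sym (nCk+nC[k+1]≡[n+1]C[k+1] i m)))
          (trans (ℤP.pos-+ (i C m) (i C suc m)) (cong (λ z → + (i C m) + z) (sym (ℤP.*-identityˡ (+ (i C suc m))))))

  translate-mul-X+ : ∀ c n u → u (suc n) ≡ +0 →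
                     translate (suc n) (mul-X+[ c ] u) ≗ mul-X+[ + 1 + c ] (translate n u)
  translate-mul-X+ c n u top≡0 m =
    trans (lincomb-mul-X+ mul-X+[ + 1 ] (mul-X+-lincomb (+ 1)) c n u _ top≡0 C-pascal m)
          (mul-X+-+ (+ 1) c (translate n u) m)

  binomialCoeff : ℤ → ℕ → ℕ → ℤ
  binomialCoeff c n i = + (n C i) * c ^ (n ∸ i)

  binomialCoeff-above : ∀ c n i → n < i → binomialCoeff c n i ≡ +0
  binomialCoeff-above c n i n<i =
    trans (cong (λ z → + z * c ^ (n ∸ i)) (k>n⇒nCk≡0 n<i)) (ℤP.*-zeroˡ (c ^ (n ∸ i)))

  binomialCoeff-suc : ∀ c n i → binomialCoeff c (suc n) i ≡ mul-X+[ c ] (binomialCoeff c n) i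
  binomialCoeff-suc c n zero    = comm c (c ^ n)
    where comm : ∀ c x → + 1 * (c * x) ≡ c * (+ 1 * x)
          comm = solve-∀
  binomialCoeff-suc c n (suc i) = begin
      + (suc n C suc i) * c ^ (n ∸ i)
    ≡⟨ cong (λ z → + z * c ^ (n ∸ i)) (sym (nCk+nC[k+1]≡[n+1]C[k+1] n i)) ⟩
      + (n C i ℕ.+ n C suc i) * c ^ (n ∸ i)
    ≡⟨ trans (cong (_* c ^ (n ∸ i)) (ℤP.pos-+ (n C i) (n C suc i)))
             (ℤP.*-distribʳ-+ (c ^ (n ∸ i)) (+ (n C i)) (+ (n C suc i))) ⟩
      + (n C i) * c ^ (n ∸ i) + + (n C suc i) * c ^ (n ∸ i)
    ≡⟨ cong (λ z → + (n C i) * c ^ (n ∸ i) + z) (lower-power (i ℕP.<? n)) ⟩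
      + (n C i) * c ^ (n ∸ i) + c * (+ (n C suc i) * c ^ (n ∸ suc i))
    ∎
    where
    open ≡-Reasoning
    lower-power : Dec (i < n) → + (n C suc i) * c ^ (n ∸ i) ≡ c * (+ (n C suc i) * c ^ (n ∸ suc i))
    lower-power (yes (s≤s i≤m)) = trans (cong (λ e → + (n C suc i) * c ^ e) (ℕP.+-∸-assoc 1 i≤m))
                                        (comm (+ (n C suc i)) c (c ^ (n ∸ suc i)))
      where comm : ∀ x c y → x * (c * y) ≡ c * (x * y)
            comm = solve-∀
    lower-power (no i≮n) rewrite k>n⇒nCk≡0 (s≤s (ℕP.≮⇒≥ i≮n)) =
      trans (ℤP.*-zeroˡ (c ^ (n ∸ i))) (sym (trans (cong (c *_) (ℤP.*-zeroˡ (c ^ (n ∸ suc i)))) (ℤP.*-zeroʳ c)))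

  binomial-expansion : ∀ c n a → E+[ c ]^[ n ] a ≗ evalE+[ +0 ] n (binomialCoeff c n) a
  binomial-expansion c zero    a k = sym (trans (ℤP.+-identityˡ _) (ℤP.*-identityˡ (a k)))
  binomial-expansion c (suc n) a k = begin
      E+[ c ]^[ suc n ] a k
    ≡⟨ E+^-suc c n a k ⟩
      E+[ c ] (E+[ c ]^[ n ] a) k
    ≡⟨ E+-cong c (binomial-expansion c n a) k ⟩
      E+[ c ] (evalE+[ +0 ] n (binomialCoeff c n) a) k
    ≡⟨ cong (λ z → E+[ z ] (evalE+[ +0 ] n (binomialCoeff c n) a) k) (sym (ℤP.+-identityˡ c)) ⟩
      E+[ +0 + c ] (evalE+[ +0 ] n (binomialCoeff c n) a) k
    ≡⟨ evalE+-mul-X+ +0 c n (binomialCoeff c n) a (binomialCoeff-above c n (suc n) (ℕP.n<1+n n)) k ⟨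
      evalE+[ +0 ] (suc n) (mul-X+[ c ] (binomialCoeff c n)) a k
    ≡⟨ lincomb-cong (suc n) (λ i → sym (binomialCoeff-suc c n i)) (λ i → E+[ +0 ]^[ i ] a) k ⟩
      evalE+[ +0 ] (suc n) (binomialCoeff c (suc n)) a k
    ∎
    where open ≡-Reasoning

  -- signed Stirling numbers of the first kind: x(x - 1)⋯(x - n + 1) = ∑ᵢ stirling₁ n i · xⁱ
  stirling₁ : ℕ → ℕ → ℤ
  stirling₁ zero    zero    = + 1
  stirling₁ zero    (suc i) = +0
  stirling₁ (suc n) i       = mul-X+[ - + n ] (stirling₁ n) i

  stirling₁-above : ∀ n i → n < i → stirling₁ n i ≡ +0
  stirling₁-above zero    (suc i) _         = refl
  stirling₁-above (suc n) (suc i) (s≤s n<i) =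
    trans (cong₂ (λ x y → x + - + n * y) (stirling₁-above n i n<i)
                 (stirling₁-above n (suc i) (ℕP.m<n⇒m<1+n n<i)))
          (trans (ℤP.+-identityˡ (- + n * +0)) (ℤP.*-zeroʳ (- + n)))

  stirling₁-diag : ∀ n → stirling₁ n n ≡ + 1
  stirling₁-diag zero    = refl
  stirling₁-diag (suc n) =
    trans (cong₂ (λ x y → x + - + n * y) (stirling₁-diag n) (stirling₁-above n (suc n) (ℕP.n<1+n n)))
          (cong (λ z → + 1 + z) (ℤP.*-zeroʳ (- + n)))

  stirling₁-zero : ∀ n → stirling₁ (suc n) 0 ≡ +0
  stirling₁-zero zero    = refl
  stirling₁-zero (suc n) = trans (cong (- + suc n *_) (stirling₁-zero n)) (ℤP.*-zeroʳ (- + suc n))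

  falling : ℤ → ℕ → Seq → Seq
  falling B zero    a = a
  falling B (suc n) a = E+[ B - + n ] (falling B n a)

  falling-expansion : ∀ B n a → falling B n a ≗ evalE+[ B ] n (stirling₁ n) a
  falling-expansion B zero    a k = sym (trans (ℤP.+-identityˡ _) (ℤP.*-identityˡ (a k)))
  falling-expansion B (suc n) a k =
    trans (E+-cong (B - + n) (falling-expansion B n a) k)
          (sym (evalE+-mul-X+ B (- + n) n (stirling₁ n) a (stirling₁-above n (suc n) (ℕP.n<1+n n)) k))

  translate-stirling₁ : ∀ n m →
    translate (suc n) (stirling₁ (suc n)) m ≡ stirling₁ (suc n) m + + suc n * stirling₁ n m
  translate-stirling₁ zero    zero          = refl
  translate-stirling₁ zero    (suc zero)    = refl
  translate-stirling₁ zero    (suc (suc m)) = refl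
  translate-stirling₁ (suc n) m = begin
      translate (2 ℕ.+ n) (mul-X+[ - + suc n ] (stirling₁ (suc n))) m
    ≡⟨ translate-mul-X+ (- + suc n) (suc n) (stirling₁ (suc n))
                        (stirling₁-above (suc n) (2 ℕ.+ n) (ℕP.n<1+n (suc n))) m ⟩
      mul-X+[ + 1 + - + suc n ] (translate (suc n) (stirling₁ (suc n))) m
    ≡⟨ mul-X+-cong (+ 1 + - + suc n) (translate-stirling₁ n) m ⟩
      mul-X+[ + 1 + - + suc n ] (λ j → stirling₁ (suc n) j + + suc n * stirling₁ n j) m
    ≡⟨ recurrence m ⟩
      stirling₁ (2 ℕ.+ n) m + + (2 ℕ.+ n) * stirling₁ (suc n) m
    ∎
    where
    open ≡-Reasoning
    recurrence : ∀ m → mul-X+[ + 1 + - + suc n ] (λ j → stirling₁ (suc n) j + + suc n * stirling₁ n j) m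
                       ≡ stirling₁ (2 ℕ.+ n) m + + (2 ℕ.+ n) * stirling₁ (suc n) m
    recurrence zero    = at-zero (+ n) (stirling₁ n 0)
      where at-zero : ∀ q x → (+ 1 + - (+ 1 + q)) * (- q * x + (+ 1 + q) * x)
                              ≡ - (+ 1 + q) * (- q * x) + (+ 1 + (+ 1 + q)) * (- q * x)
            at-zero = solve-∀
    recurrence (suc m) = at-suc (+ n) (stirling₁ (suc n) m) (stirling₁ n m) (stirling₁ n (suc m))
      where at-suc : ∀ q a b c → (a + (+ 1 + q) * b) + (+ 1 + - (+ 1 + q)) * ((b + - q * c) + (+ 1 + q) * c)
                                 ≡ (a + - (+ 1 + q) * (b + - q * c)) + (+ 1 + (+ 1 + q)) * (b + - q * c)
            at-suc = solve-∀

open ShiftOperators using (Seq; E+[_]^[_])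

module SingletonRules where

  open import Data.Bool.Base using (Bool; true; false)
  import Data.Bool.Properties as BoolP
  open import Data.Nat.Base as ℕ using (ℕ; zero; suc; _+_; _*_; _<_; s≤s)
  import Data.Nat.Properties as ℕP
  open import Data.Nat.Induction using (<-rec)
  open import Data.Nat.Tactic.RingSolver using (solve-∀)
  open import Data.Fin.Base using (Fin; zero; suc)
  open import Data.Fin.Subset using (Subset; _─_; _-_; ⁅_⁆; ⊤; ⊥; ∣_∣; _∈_; _∉_; _⊆_)
  open import Data.Fin.Subset.Properties
    using (_⊆?_; _∈?_; ⊥⊆; ∣⊤∣≡n; ∣p∣≤n; p─⊥≡p; p─q⊆p; p─q─r≡p─r─q; x∈⁅x⁆;
           x∈p∧x∉q⇒x∈p─q; x∈p∧x≢y⇒x∈p-y)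
  open import Data.Vec.Base using ([]; _∷_; here; there; lookup)
  import Data.Vec.Properties as VecP
  open import Data.Vec.Functional using (Vector; head; tail; updateAt)
  open import Data.Vec.Functional.Properties using (updateAt-updates; updateAt-id-local; updateAt-updateAt)
  open import Data.Integer.Base as ℤ using (ℤ) renaming (+_ to pos)
  import Data.Integer.Properties as ℤP
  import Data.Integer.Tactic.RingSolver as ℤSolver
  open import Data.Product.Base using (∃; _,_)
  open import Data.List.Base using (List; []; _∷_; map; _++_)
  open import Data.Empty using (⊥-elim) renaming (⊥ to Void)
  open import Data.Unit.Base using (tt) renaming (⊤ to Unit)
  open import Function.Base using (const; _∘_)
  open import Relation.Nullary using (Dec; yes; no; does; ¬_; ¬?)
  open import Relation.Nullary.Decidable using (dec-true; dec-false; does-⇔)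
  open import Function.Bundles using (_⇔_; mk⇔; Equivalence)
  open import Relation.Binary.PropositionalEquality
  open import Defs using (allSubsets)

  sumOver : ∀ {A : Set} → List A → (A → ℕ) → ℕ
  sumOver []       f = 0
  sumOver (x ∷ xs) f = f x + sumOver xs f

  module _ {A : Set} where

    sumOver-++ : ∀ (xs ys : List A) f → sumOver (xs ++ ys) f ≡ sumOver xs f + sumOver ys f
    sumOver-++ []       ys f = refl
    sumOver-++ (x ∷ xs) ys f = trans (cong (f x +_) (sumOver-++ xs ys f)) (sym (ℕP.+-assoc (f x) _ _))

    sumOver-map : ∀ {B : Set} (g : A → B) xs f → sumOver (map g xs) f ≡ sumOver xs (f ∘ g)
    sumOver-map g []       f = refl
    sumOver-map g (x ∷ xs) f = cong (f (g x) +_) (sumOver-map g xs f)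

    sumOver-cong : ∀ (xs : List A) {f g} → (∀ x → f x ≡ g x) → sumOver xs f ≡ sumOver xs g
    sumOver-cong []       f≗g = refl
    sumOver-cong (x ∷ xs) f≗g = cong₂ _+_ (f≗g x) (sumOver-cong xs f≗g)

    sumOver-+ : ∀ (xs : List A) f g → sumOver xs (λ x → f x + g x) ≡ sumOver xs f + sumOver xs g
    sumOver-+ []       f g = refl
    sumOver-+ (x ∷ xs) f g = trans (cong (f x + g x +_) (sumOver-+ xs f g)) (swap (f x) (g x) _ _)
      where swap : ∀ a b c d → a + b + (c + d) ≡ (a + c) + (b + d)
            swap = solve-∀

    sumOver-* : ∀ (xs : List A) k f → sumOver xs (λ x → k * f x) ≡ k * sumOver xs f
    sumOver-* []       k f = sym (ℕP.*-zeroʳ k)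
    sumOver-* (x ∷ xs) k f = trans (cong (k * f x +_) (sumOver-* xs k f)) (sym (ℕP.*-distribˡ-+ k (f x) _))

    sumOver-zero : ∀ (xs : List A) f → (∀ x → f x ≡ 0) → sumOver xs f ≡ 0
    sumOver-zero []       f f≡0 = refl
    sumOver-zero (x ∷ xs) f f≡0 = cong₂ _+_ (f≡0 x) (sumOver-zero xs f f≡0)

  sumOver-allSubsets : ∀ m f → sumOver (allSubsets (suc m)) f
                               ≡ sumOver (allSubsets m) (f ∘ (true ∷_)) + sumOver (allSubsets m) (f ∘ (false ∷_))
  sumOver-allSubsets m f =
    trans (sumOver-++ (map (true ∷_) (allSubsets m)) _ f)
          (cong₂ _+_ (sumOver-map (true ∷_) (allSubsets m) f) (sumOver-map (false ∷_) (allSubsets m) f))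

  𝟙 : Bool → ℕ
  𝟙 true  = 1
  𝟙 false = 0

  _≟ˢ_ : ∀ {m} (c d : Subset m) → Dec (c ≡ d)
  _≟ˢ_ = VecP.≡-dec BoolP._≟_

  sumOver-allSubsets-≡⊥ : ∀ m (h : Subset m → ℕ) →
                          sumOver (allSubsets m) (λ c → 𝟙 (does (c ≟ˢ ⊥)) * h c) ≡ h ⊥
  sumOver-allSubsets-≡⊥ zero    h = trans (ℕP.+-identityʳ _) (ℕP.*-identityˡ _)
  sumOver-allSubsets-≡⊥ (suc m) h =
    trans (sumOver-allSubsets m (λ c → 𝟙 (does (c ≟ˢ ⊥)) * h c))
          (cong₂ _+_ (sumOver-zero (allSubsets m) _ (λ _ → refl)) (sumOver-allSubsets-≡⊥ m (h ∘ (false ∷_))))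

  x∈p─q⇒x∉q : ∀ {m} (p q : Subset m) {x} → x ∈ p ─ q → x ∉ q
  x∈p─q⇒x∉q (_ ∷ p) (true  ∷ q) {zero}  ()
  x∈p─q⇒x∉q (_ ∷ p) (false ∷ q) {zero}  _          ()
  x∈p─q⇒x∉q (_ ∷ p) (_     ∷ q) {suc x} (there x∈) (there x∈q) = x∈p─q⇒x∉q p q x∈ x∈q

  x∉p-x : ∀ {m} (p : Subset m) x → x ∉ p - x
  x∉p-x p x x∈p-x = x∈p─q⇒x∉q p ⁅ x ⁆ x∈p-x (x∈⁅x⁆ x)

  data Rule : Set where
    required forbidden free : Rule

  Holds : Rule → Set → Set
  Holds required  P = P
  Holds forbidden P = ¬ P
  Holds free      P = Unit

  holds? : ∀ r {P} → Dec P → Dec (Holds r P)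
  holds? required  P? = P?
  holds? forbidden P? = ¬? P?
  holds? free      P? = yes tt

  Holds-cong : ∀ r {P Q : Set} → P ⇔ Q → Holds r P ⇔ Holds r Q
  Holds-cong required  P⇔Q = P⇔Q
  Holds-cong forbidden P⇔Q = mk⇔ (λ ¬p → ¬p ∘ Equivalence.from P⇔Q) (λ ¬q → ¬q ∘ Equivalence.to P⇔Q)
  Holds-cong free      P⇔Q = mk⇔ (λ _ → tt) (λ _ → tt)

  weight : ∀ r {P} → Dec P → ℕ
  weight r P? = 𝟙 (does (holds? r P?))

  weight-free : ∀ {P} (P? : Dec P) → weight free P? ≡ weight required P? + weight forbidden P?
  weight-free (yes _) = refl
  weight-free (no  _) = refl

  Rules : ℕ → Set
  Rules = Vector Rule

  _[_]≔_ : ∀ {m} → Rules m → Fin m → Rule → Rules m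
  σ [ x ]≔ r = updateAt σ x (const r)

  never : Dec Void
  never = no λ ()

  -- 1 if c ⊆ U can be the rest of the block of a point whose singleton rule is r, else 0
  blockWeight : ∀ {m} → Subset m → Subset m → Rule → ℕ
  blockWeight U c r = 𝟙 (does (c ⊆? U)) * weight r (c ≟ˢ ⊥)

  blockWeight-free : ∀ {m} (U c : Subset m) →
                     blockWeight U c free ≡ blockWeight U c required + blockWeight U c forbidden
  blockWeight-free U c =
    trans (cong (𝟙 (does (c ⊆? U)) *_) (weight-free (c ≟ˢ ⊥))) (ℕP.*-distribˡ-+ (𝟙 (does (c ⊆? U))) _ _)

  -- Partitions of U ⊆ Fin m whose singleton blocks obey σ.  A first point outside U is never a
  -- singleton; otherwise the count is split by the rest c of its block, and {0} is a block iff c ≡ ⊥.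
  countParts : (m : ℕ) → Subset m → Rules m → ℕ
  countParts zero    []          σ = 1
  countParts (suc m) (false ∷ U) σ = weight (head σ) never * countParts m U (tail σ)
  countParts (suc m) (true ∷ U)  σ =
    sumOver (allSubsets m) (λ c → blockWeight U c (head σ) * countParts m (U ─ c) (tail σ))

  countParts-cong : ∀ m U {σ τ} → (∀ j → σ j ≡ τ j) → countParts m U σ ≡ countParts m U τ
  countParts-cong zero    []          σ≗τ = refl
  countParts-cong (suc m) (false ∷ U) σ≗τ =
    cong₂ (λ r n → weight r never * n) (σ≗τ zero) (countParts-cong m U (σ≗τ ∘ suc))
  countParts-cong (suc m) (true ∷ U)  σ≗τ = sumOver-cong (allSubsets m) (λ c →
    cong₂ (λ r n → blockWeight U c r * n) (σ≗τ zero) (countParts-cong m (U ─ c) (σ≗τ ∘ suc)))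

  countParts-required-outside : ∀ m U (σ : Rules m) x → σ x ≡ required → x ∉ U → countParts m U σ ≡ 0
  countParts-required-outside (suc m) (false ∷ U) σ zero    σx≡req x∉U rewrite σx≡req = refl
  countParts-required-outside (suc m) (true ∷ U)  σ zero    σx≡req x∉U = ⊥-elim (x∉U here)
  countParts-required-outside (suc m) (false ∷ U) σ (suc x) σx≡req x∉U =
    trans (cong (weight (head σ) never *_) (countParts-required-outside m U (tail σ) x σx≡req (x∉U ∘ there)))
          (ℕP.*-zeroʳ (weight (head σ) never))
  countParts-required-outside (suc m) (true ∷ U)  σ (suc x) σx≡req x∉U = sumOver-zero (allSubsets m) _ (λ c →
    trans (cong (blockWeight U c (head σ) *_)
                (countParts-required-outside m (U ─ c) (tail σ) x σx≡req (x∉U ∘ there ∘ p─q⊆p U c)))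
          (ℕP.*-zeroʳ (blockWeight U c (head σ))))

  countParts-free : ∀ m U (σ : Rules m) x → countParts m U (σ [ x ]≔ free)
                    ≡ countParts m U (σ [ x ]≔ required) + countParts m U (σ [ x ]≔ forbidden)
  countParts-free (suc m) (false ∷ U) σ zero    = refl
  countParts-free (suc m) (true ∷ U)  σ zero    =
    trans (sumOver-cong (allSubsets m) (λ c →
             trans (cong (_* countParts m (U ─ c) (tail σ)) (blockWeight-free U c))
                   (ℕP.*-distribʳ-+ (countParts m (U ─ c) (tail σ)) (blockWeight U c required) _)))
          (sumOver-+ (allSubsets m) _ _)
  countParts-free (suc m) (false ∷ U) σ (suc x) =
    trans (cong (weight (head σ) never *_) (countParts-free m U (tail σ) x))
          (ℕP.*-distribˡ-+ (weight (head σ) never) _ _)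
  countParts-free (suc m) (true ∷ U)  σ (suc x) =
    trans (sumOver-cong (allSubsets m) (λ c →
             trans (cong (blockWeight U c (head σ) *_) (countParts-free m (U ─ c) (tail σ) x))
                   (ℕP.*-distribˡ-+ (blockWeight U c (head σ)) _ _)))
          (sumOver-+ (allSubsets m) _ _)

  ⊆-⇔-⊆-minus : ∀ {m} {c U : Subset m} {x} → x ∉ c → c ⊆ U ⇔ c ⊆ U - x
  ⊆-⇔-⊆-minus {c = c} {U} {x} x∉c =
    mk⇔ (λ c⊆U {_} i∈c → x∈p∧x≢y⇒x∈p-y (c⊆U i∈c) (λ { refl → x∉c i∈c }))
        (λ c⊆U-x {_} i∈c → p─q⊆p U ⁅ x ⁆ (c⊆U-x i∈c))

  countParts-required : ∀ m U (σ : Rules m) x → σ x ≡ required → x ∈ U →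
                        countParts m U σ ≡ countParts m (U - x) (σ [ x ]≔ free)
  countParts-required (suc m) (true ∷ U)  σ zero    σx≡req _ rewrite σx≡req = begin
      sumOver (allSubsets m) (λ c → 𝟙 (does (c ⊆? U)) * 𝟙 (does (c ≟ˢ ⊥)) * R c)
    ≡⟨ sumOver-cong (allSubsets m) (λ c → swap (𝟙 (does (c ⊆? U))) (𝟙 (does (c ≟ˢ ⊥))) (R c)) ⟩
      sumOver (allSubsets m) (λ c → 𝟙 (does (c ≟ˢ ⊥)) * (𝟙 (does (c ⊆? U)) * R c))
    ≡⟨ sumOver-allSubsets-≡⊥ m (λ c → 𝟙 (does (c ⊆? U)) * R c) ⟩
      𝟙 (does (⊥ ⊆? U)) * R ⊥
    ≡⟨ cong (λ b → 𝟙 b * R ⊥) (dec-true (⊥ ⊆? U) ⊥⊆) ⟩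
      1 * R ⊥
    ∎
    where
    open ≡-Reasoning
    R : Subset m → ℕ
    R c = countParts m (U ─ c) (tail σ)
    swap : ∀ a b n → a * b * n ≡ b * (a * n)
    swap = solve-∀
  countParts-required (suc m) (false ∷ U) σ (suc x) σx≡req (there x∈U) =
    cong (weight (head σ) never *_) (countParts-required m U (tail σ) x σx≡req x∈U)
  countParts-required (suc m) (true ∷ U)  σ (suc x) σx≡req (there x∈U) = sumOver-cong (allSubsets m) term
    where
    term : ∀ c → blockWeight U c (head σ) * countParts m (U ─ c) (tail σ)
               ≡ blockWeight (U - x) c (head σ) * countParts m ((U - x) ─ c) (tail σ [ x ]≔ free)
    term c with x ∈? c
    ... | yes x∈c =
      trans (cong (blockWeight U c (head σ) *_)
                  (countParts-required-outside m (U ─ c) (tail σ) x σx≡req (λ x∈ → x∈p─q⇒x∉q U c x∈ x∈c)))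
      (trans (ℕP.*-zeroʳ (blockWeight U c (head σ)))
             (cong (λ b → 𝟙 b * weight (head σ) (c ≟ˢ ⊥) * countParts m ((U - x) ─ c) (tail σ [ x ]≔ free))
                   (sym (dec-false (c ⊆? U - x) (λ c⊆U-x → x∉p-x U x (c⊆U-x x∈c))))))
    ... | no x∉c  = cong₂ (λ b n → 𝟙 b * weight (head σ) (c ≟ˢ ⊥) * n)
                          (does-⇔ (⊆-⇔-⊆-minus x∉c) (c ⊆? U) (c ⊆? U - x))
                          (trans (countParts-required m (U ─ c) (tail σ) x σx≡req (x∈p∧x∉q⇒x∈p─q x∈U x∉c))
                                 (cong (λ V → countParts m V (tail σ [ x ]≔ free))
                                       (p─q─r≡p─r─q U c ⁅ x ⁆)))

  -- binomialSum u f = ∑ᵢ C(u, i) · f i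
  binomialSum : ℕ → (ℕ → ℕ) → ℕ
  binomialSum zero    f = f 0
  binomialSum (suc u) f = binomialSum u f + binomialSum u (f ∘ suc)

  sumOver-⊆ : ∀ m (U : Subset m) f →
              sumOver (allSubsets m) (λ c → 𝟙 (does (c ⊆? U)) * f ∣ U ─ c ∣) ≡ binomialSum ∣ U ∣ f
  sumOver-⊆ zero    []          f = trans (ℕP.+-identityʳ _) (ℕP.*-identityˡ _)
  sumOver-⊆ (suc m) (false ∷ U) f =
    trans (sumOver-allSubsets m _) (cong₂ _+_ (sumOver-zero (allSubsets m) _ (λ c → refl)) (sumOver-⊆ m U f))
  sumOver-⊆ (suc m) (true ∷ U)  f =
    trans (sumOver-allSubsets m _) (cong₂ _+_ (sumOver-⊆ m U f) (sumOver-⊆ m U (f ∘ suc)))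

  allFree : ∀ {m} → Rules m
  allFree = const free

  bell : ℕ → ℕ
  bell n = countParts n ⊤ allFree

  -- Stated with its hypothesis so that it can serve inside the strong induction below.
  bell-step : ∀ u → (∀ (U : Subset u) → countParts u U allFree ≡ bell ∣ U ∣) →
              bell (suc u) ≡ binomialSum u bell
  bell-step u free-count =
    trans (sumOver-cong (allSubsets u) (λ c →
             cong₂ _*_ (ℕP.*-identityʳ (𝟙 (does (c ⊆? ⊤)))) (free-count (⊤ ─ c))))
          (trans (sumOver-⊆ u ⊤ bell) (cong (λ n → binomialSum n bell) (∣⊤∣≡n u)))

  countParts-allFree : ∀ m (U : Subset m) → countParts m U allFree ≡ bell ∣ U ∣
  countParts-allFree = <-rec (λ m → ∀ (U : Subset m) → countParts m U allFree ≡ bell ∣ U ∣) step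
    where
    step : ∀ m → (∀ {m′} → m′ < m → ∀ (U : Subset m′) → countParts m′ U allFree ≡ bell ∣ U ∣) →
           ∀ (U : Subset m) → countParts m U allFree ≡ bell ∣ U ∣
    step zero    smaller []          = refl
    step (suc m) smaller (false ∷ U) = trans (ℕP.+-identityʳ _) (smaller ℕP.≤-refl U)
    step (suc m) smaller (true ∷ U)  =
      trans (sumOver-cong (allSubsets m) (λ c →
               cong₂ _*_ (ℕP.*-identityʳ (𝟙 (does (c ⊆? U)))) (smaller ℕP.≤-refl (U ─ c))))
            (trans (sumOver-⊆ m U bell) (sym (bell-step ∣ U ∣ (smaller (s≤s (∣p∣≤n U))))))

  bell-rec : ∀ u → bell (suc u) ≡ binomialSum u bell
  bell-rec u = bell-step u (countParts-allFree u)

  forbidIf : Bool → Rule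
  forbidIf true  = forbidden
  forbidIf false = free

  forbid : ∀ {m} → Subset m → Rules m
  forbid S j = forbidIf (lookup S j)

  forbid-size-zero : ∀ {m} (S : Subset m) → ∣ S ∣ ≡ 0 → ∀ j → forbid S j ≡ free
  forbid-size-zero (false ∷ S) ∣S∣≡0 zero    = refl
  forbid-size-zero (false ∷ S) ∣S∣≡0 (suc j) = forbid-size-zero S ∣S∣≡0 j

  forbid-minus : ∀ {m} (S : Subset m) x j → (forbid S [ x ]≔ free) j ≡ forbid (S - x) j
  forbid-minus (s ∷ S) zero    zero    = refl
  forbid-minus (s ∷ S) zero    (suc j) = cong (λ V → forbidIf (lookup V j)) (sym (p─⊥≡p S))
  forbid-minus (s ∷ S) (suc x) zero    = refl
  forbid-minus (s ∷ S) (suc x) (suc j) = forbid-minus S x j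

  forbid-member : ∀ {m} (S : Subset m) {x} → x ∈ S → ∀ j → (forbid S [ x ]≔ forbidden) j ≡ forbid S j
  forbid-member S {x} x∈S = updateAt-id-local x (forbid S) (cong forbidIf (sym (VecP.[]=⇒lookup x∈S)))

  member-of-size-suc : ∀ {m} (S : Subset m) {s} → ∣ S ∣ ≡ suc s → ∃ λ x → x ∈ S
  member-of-size-suc (true  ∷ S) _      = zero , here
  member-of-size-suc (false ∷ S) ∣S∣≡1+s with x , x∈S ← member-of-size-suc S ∣S∣≡1+s = suc x , there x∈S

  size-minus : ∀ {m} (S : Subset m) {x} → x ∈ S → ∣ S ∣ ≡ suc ∣ S - x ∣
  size-minus (true  ∷ S) here        = cong (suc ∘ ∣_∣) (sym (p─⊥≡p S))
  size-minus (true  ∷ S) (there x∈S) = cong suc (size-minus S x∈S)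
  size-minus (false ∷ S) (there x∈S) = size-minus S x∈S

  minus-⊆ : ∀ {m} {S U : Subset m} x → S ⊆ U → S - x ⊆ U - x
  minus-⊆ {S = S} {U} x S⊆U i∈S-x =
    x∈p∧x∉q⇒x∈p─q (S⊆U (p─q⊆p S ⁅ x ⁆ i∈S-x)) (x∈p─q⇒x∉q S ⁅ x ⁆ i∈S-x)

  -- avoiding u s: partitions of a u-element set in which s given elements are not singletons
  avoiding : ℕ → ℕ → ℤ
  avoiding u zero    = pos (bell u)
  avoiding u (suc s) = avoiding u s ℤ.- avoiding (ℕ.pred u) s

  -- inclusion–exclusion on one forbidden element: forbidden = free - required
  countParts-forbid : ∀ s m U (S : Subset m) → S ⊆ U → ∣ S ∣ ≡ s →
                      pos (countParts m U (forbid S)) ≡ avoiding ∣ U ∣ s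
  countParts-forbid zero    m U S S⊆U ∣S∣≡0 =
    cong pos (trans (countParts-cong m U (forbid-size-zero S ∣S∣≡0)) (countParts-allFree m U))
  countParts-forbid (suc s) m U S S⊆U ∣S∣≡1+s with x , x∈S ← member-of-size-suc S ∣S∣≡1+s = begin
      pos (countParts m U (forbid S))
    ≡⟨ cong pos (countParts-cong m U (forbid-member S x∈S)) ⟨
      pos (countParts m U (σ [ x ]≔ forbidden))
    ≡⟨ cancel (countParts m U (σ [ x ]≔ required)) _ ⟨
      pos (countParts m U (σ [ x ]≔ required) + countParts m U (σ [ x ]≔ forbidden))
        ℤ.- pos (countParts m U (σ [ x ]≔ required))
    ≡⟨ cong₂ (λ a b → pos a ℤ.- pos b) (sym (countParts-free m U σ x))
             (countParts-required m U (σ [ x ]≔ required) x (updateAt-updates x σ) (S⊆U x∈S)) ⟩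
      pos (countParts m U (σ [ x ]≔ free)) ℤ.- pos (countParts m (U - x) ((σ [ x ]≔ required) [ x ]≔ free))
    ≡⟨ cong₂ (λ a b → pos a ℤ.- pos b) (countParts-cong m U (forbid-minus S x))
             (countParts-cong m (U - x) (λ j → trans (updateAt-updateAt x σ j) (forbid-minus S x j))) ⟩
      pos (countParts m U (forbid (S - x))) ℤ.- pos (countParts m (U - x) (forbid (S - x)))
    ≡⟨ cong₂ ℤ._-_ (countParts-forbid s m U (S - x) (S⊆U ∘ p─q⊆p S ⁅ x ⁆) ∣S-x∣≡s)
                 (countParts-forbid s m (U - x) (S - x) (minus-⊆ x S⊆U) ∣S-x∣≡s) ⟩
      avoiding (∣ U ∣) s ℤ.- avoiding (∣ U - x ∣) s
    ≡⟨ cong (λ u → avoiding (∣ U ∣) s ℤ.- avoiding u s) (cong ℕ.pred (sym (size-minus U (S⊆U x∈S)))) ⟩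
      avoiding ∣ U ∣ (suc s)
    ∎
    where
    open ≡-Reasoning
    σ = forbid S
    ∣S-x∣≡s : ∣ S - x ∣ ≡ s
    ∣S-x∣≡s = ℕP.suc-injective (trans (sym (size-minus S x∈S)) ∣S∣≡1+s)
    cancel : ∀ a b → pos (a + b) ℤ.- pos a ≡ pos b
    cancel a b = trans (cong (ℤ._- pos a) (ℤP.pos-+ a b)) (add-sub (pos a) (pos b))
      where add-sub : ∀ x y → x ℤ.+ y ℤ.- x ≡ y
            add-sub = ℤSolver.solve-∀

module BruteForce where

  open import Data.Bool.Base using (true; false; _∧_)
  open import Data.Nat.Base using (ℕ; zero; suc; _+_; _*_)
  import Data.Nat.Properties as ℕP
  open import Data.Fin.Base using (zero; suc)
  open import Data.Fin.Subset using (Subset; _─_; ⁅_⁆; ⊥; _∈_; _⊆_; _∩_; Nonempty; Empty)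
  open import Data.Fin.Subset.Properties
    using (_∈?_; _⊆?_; nonempty?; drop-there; drop-∷-⊆; out⊆; in⊆in; x∈p∩q⁺; x∈p∩q⁻; p─q⊆p;
           x∈p∧x∉q⇒x∈p─q)
  open import Data.Fin.Properties using (all?)
  open import Data.Vec.Base using ([]; _∷_; here; there)
  open import Data.Vec.Functional using (head; tail)
  open import Data.List.Base using (List; []; _∷_; [_]; map; _++_; filter; length)
  open import Data.List.Relation.Unary.All as All using (All; []; _∷_) renaming (all? to allL?)
  import Data.List.Relation.Unary.All.Properties as All
  open import Data.List.Relation.Unary.Any as Any using (Any; here; there) renaming (any? to anyL?)
  import Data.List.Relation.Unary.Any.Properties as Any
  open import Data.List.Relation.Unary.AllPairs as AllPairs using (AllPairs; []; _∷_)
  import Data.List.Relation.Unary.AllPairs.Properties as AllPairs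
  import Data.List.Membership.Propositional as Mem
  open import Data.Product.Base using (_×_; _,_; proj₁)
  open import Data.Empty using (⊥-elim) renaming (⊥ to Void)
  open import Function.Base using (_∘_)
  open import Function.Bundles using (_⇔_; mk⇔; Equivalence)
  open import Relation.Nullary using (Dec; yes; no; does; ¬_; _×-dec_; _→-dec_)
  open import Relation.Nullary.Decidable using (map′; does-⇔; dec-true; dec-false)
  open import Relation.Binary.PropositionalEquality hiding ([_])
  open import Defs using (allSubsets; sublists; empty?; _∈L?_)
  open SingletonRules

  length-filter : ∀ {A : Set} {P : A → Set} (P? : ∀ x → Dec (P x)) xs →
                  length (filter P? xs) ≡ sumOver xs (λ x → 𝟙 (does (P? x)))
  length-filter P? []       = refl
  length-filter P? (x ∷ xs) with does (P? x)
  ... | true  = cong suc (length-filter P? xs)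
  ... | false = length-filter P? xs

  𝟙-∧ : ∀ a b → 𝟙 (a ∧ b) ≡ 𝟙 a * 𝟙 b
  𝟙-∧ true  b = sym (ℕP.+-identityʳ (𝟙 b))
  𝟙-∧ false b = refl

  module _ {A : Set} where

    sumOver-sublists-++ : ∀ (xs ys : List A) f →
      sumOver (sublists (xs ++ ys)) f ≡ sumOver (sublists xs) (λ as → sumOver (sublists ys) (λ bs → f (as ++ bs)))
    sumOver-sublists-++ []       ys f = sym (ℕP.+-identityʳ _)
    sumOver-sublists-++ (x ∷ xs) ys f =
      trans (sumOver-++ (map (x ∷_) (sublists (xs ++ ys))) _ f)
      (trans (cong₂ _+_ (trans (sumOver-map (x ∷_) (sublists (xs ++ ys)) f)
                               (sumOver-sublists-++ xs ys (f ∘ (x ∷_))))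
                        (sumOver-sublists-++ xs ys f))
             (sym (trans (sumOver-++ (map (x ∷_) (sublists xs)) _ _)
                         (cong (_+ _) (sumOver-map (x ∷_) (sublists xs) _)))))

    sumOver-sublists-map : ∀ {B : Set} (g : A → B) xs f →
                           sumOver (sublists (map g xs)) f ≡ sumOver (sublists xs) (f ∘ map g)
    sumOver-sublists-map g []       f = refl
    sumOver-sublists-map g (x ∷ xs) f =
      trans (sumOver-++ (map (g x ∷_) (sublists (map g xs))) _ f)
      (trans (cong₂ _+_ (trans (sumOver-map (g x ∷_) (sublists (map g xs)) f)
                               (sumOver-sublists-map g xs (f ∘ (g x ∷_))))
                        (sumOver-sublists-map g xs f))
             (sym (trans (sumOver-++ (map (x ∷_) (sublists xs)) _ _)
                         (cong (_+ _) (sumOver-map (x ∷_) (sublists xs) _)))))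

    sumOver-sublists-empty : ∀ (xs : List A) g → (∀ a as → g (a ∷ as) ≡ 0) → sumOver (sublists xs) g ≡ g []
    sumOver-sublists-empty []       g g∷≡0 = ℕP.+-identityʳ _
    sumOver-sublists-empty (x ∷ xs) g g∷≡0 =
      trans (sumOver-++ (map (x ∷_) (sublists xs)) _ g)
            (cong₂ _+_ (trans (sumOver-map (x ∷_) (sublists xs) g) (sumOver-zero (sublists xs) _ (g∷≡0 x)))
                       (sumOver-sublists-empty xs g g∷≡0))

    sumOver-sublists-singletons : ∀ (xs : List A) g → g [] ≡ 0 → (∀ a b as → g (a ∷ b ∷ as) ≡ 0) →
                                  sumOver (sublists xs) g ≡ sumOver xs (λ a → g [ a ])
    sumOver-sublists-singletons []       g g[]≡0 g∷∷≡0 = trans (ℕP.+-identityʳ _) g[]≡0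
    sumOver-sublists-singletons (x ∷ xs) g g[]≡0 g∷∷≡0 =
      trans (sumOver-++ (map (x ∷_) (sublists xs)) _ g)
            (cong₂ _+_ (trans (sumOver-map (x ∷_) (sublists xs) g)
                              (sumOver-sublists-empty xs (g ∘ (x ∷_)) (g∷∷≡0 x)))
                       (sumOver-sublists-singletons xs g g[]≡0 g∷∷≡0))

  record PartitionOf {m} (U : Subset m) (bs : List (Subset m)) : Set where
    constructor mkPartition
    field
      nonempty : All Nonempty bs
      disjoint : AllPairs (λ b c → Empty (b ∩ c)) bs
      inside   : All (_⊆ U) bs
      covers   : ∀ i → i ∈ U → Any (i ∈_) bs

  partitionOf? : ∀ {m} (U : Subset m) bs → Dec (PartitionOf U bs)
  partitionOf? U bs =
    map′ (λ (ne , dj , sb , cv) → mkPartition ne dj sb cv) (λ (mkPartition ne dj sb cv) → ne , dj , sb , cv)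
         (allL? nonempty? bs ×-dec AllPairs.allPairs? (λ b c → empty? (b ∩ c)) bs ×-dec
          allL? (_⊆? U) bs ×-dec all? (λ i → (i ∈? U) →-dec anyL? (i ∈?_) bs))

  Obeys : ∀ {m} → Rules m → List (Subset m) → Set
  Obeys σ bs = ∀ j → Holds (σ j) (⁅ j ⁆ Mem.∈ bs)

  obeys? : ∀ {m} (σ : Rules m) bs → Dec (Obeys σ bs)
  obeys? σ bs = all? (λ j → holds? (σ j) (⁅ j ⁆ ∈L? bs))

  PartitionObeying : ∀ {m} → Subset m → Rules m → List (Subset m) → Set
  PartitionObeying U σ bs = PartitionOf U bs × Obeys σ bs

  partitionObeying? : ∀ {m} (U : Subset m) σ bs → Dec (PartitionObeying U σ bs)
  partitionObeying? U σ bs = partitionOf? U bs ×-dec obeys? σ bs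

  bruteCount : (m : ℕ) → Subset m → Rules m → ℕ
  bruteCount m U σ = sumOver (sublists (allSubsets m)) (λ bs → 𝟙 (does (partitionObeying? U σ bs)))

  liftBlocks : ∀ {m} → List (Subset m) → List (Subset (suc m))
  liftBlocks = map (false ∷_)

  Nonempty-tail : ∀ {m} {d : Subset m} → Nonempty (false ∷ d) → Nonempty d
  Nonempty-tail (suc i , there i∈d) = i , i∈d

  Nonempty-lift : ∀ {m} {d : Subset m} → Nonempty d → Nonempty (false ∷ d)
  Nonempty-lift (i , i∈d) = suc i , there i∈d

  Empty-tail : ∀ {m} {d : Subset m} → Empty (false ∷ d) → Empty d
  Empty-tail empty (i , i∈d) = empty (suc i , there i∈d)

  Empty-lift : ∀ {m} {d : Subset m} → Empty d → Empty (false ∷ d)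
  Empty-lift empty (suc i , there i∈d) = empty (i , i∈d)

  zero∉liftBlocks : ∀ {m} (D : List (Subset m)) → ¬ Any (zero ∈_) (liftBlocks D)
  zero∉liftBlocks (d ∷ D) (there zero∈) = zero∉liftBlocks D zero∈

  ∈-liftBlocks : ∀ {m} {y : Subset m} {D} → (false ∷ y) Mem.∈ liftBlocks D ⇔ y Mem.∈ D
  ∈-liftBlocks = mk⇔ (Any.map (λ { refl → refl }) ∘ Any.map⁻) (Any.map⁺ ∘ Any.map (cong (false ∷_)))

  inside∉liftBlocks : ∀ {m} {y : Subset m} D → ¬ (true ∷ y) Mem.∈ liftBlocks D
  inside∉liftBlocks (d ∷ D) (there y∈) = inside∉liftBlocks D y∈

  PartitionOf-outside : ∀ {m} {U : Subset m} {D} → PartitionOf (false ∷ U) (liftBlocks D) ⇔ PartitionOf U D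
  PartitionOf-outside {U = U} {D} = mk⇔
    (λ (mkPartition ne dj sb cv) →
       mkPartition (All.map Nonempty-tail (All.map⁻ ne)) (AllPairs.map Empty-tail (AllPairs.map⁻ dj))
                   (All.map drop-∷-⊆ (All.map⁻ sb))
                   (λ i i∈U → Any.map drop-there (Any.map⁻ (cv (suc i) (there i∈U)))))
    (λ (mkPartition ne dj sb cv) →
       mkPartition (All.map⁺ (All.map Nonempty-lift ne)) (AllPairs.map⁺ (AllPairs.map Empty-lift dj))
                   (All.map⁺ (All.map out⊆ sb)) λ { (suc i) (there i∈U) → Any.map⁺ (Any.map there (cv i i∈U)) })

  PartitionOf-inside : ∀ {m} {U c : Subset m} {D} →
                       PartitionOf (true ∷ U) ((true ∷ c) ∷ liftBlocks D) ⇔ (c ⊆ U × PartitionOf (U ─ c) D)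
  PartitionOf-inside {U = U} {c} {D} = mk⇔ to from
    where
    to : PartitionOf (true ∷ U) ((true ∷ c) ∷ liftBlocks D) → c ⊆ U × PartitionOf (U ─ c) D
    to (mkPartition (_ ∷ ne) (c-disjoint ∷ dj) (c⊆U ∷ sb) cv) =
      drop-∷-⊆ c⊆U ,
      mkPartition (All.map Nonempty-tail (All.map⁻ ne)) (AllPairs.map Empty-tail (AllPairs.map⁻ dj))
                  (All.zipWith inside-rest (All.map⁻ c-disjoint , All.map⁻ sb)) covers-rest
      where
      inside-rest : ∀ {d} → Empty ((true ∷ c) ∩ (false ∷ d)) × (false ∷ d) ⊆ (true ∷ U) → d ⊆ U ─ c
      inside-rest {d} (disjoint , d⊆U) {i} i∈d =
        x∈p∧x∉q⇒x∈p─q (drop-∷-⊆ d⊆U i∈d)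
                      (λ i∈c → disjoint (suc i , x∈p∩q⁺ {p = true ∷ c} {q = false ∷ d} (there i∈c , there i∈d)))
      covers-rest : ∀ i → i ∈ U ─ c → Any (i ∈_) D
      covers-rest i i∈U─c with cv (suc i) (there (p─q⊆p U c i∈U─c))
      ... | here (there i∈c) = ⊥-elim (x∈p─q⇒x∉q U c i∈U─c i∈c)
      ... | there i∈D        = Any.map drop-there (Any.map⁻ i∈D)
    from : c ⊆ U × PartitionOf (U ─ c) D → PartitionOf (true ∷ U) ((true ∷ c) ∷ liftBlocks D)
    from (c⊆U , mkPartition ne dj sb cv) =
      mkPartition ((zero , here) ∷ All.map⁺ (All.map Nonempty-lift ne))
                  (All.map⁺ (All.map c-disjoint sb) ∷ AllPairs.map⁺ (AllPairs.map Empty-lift dj))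
                  (in⊆in c⊆U ∷ All.map⁺ (All.map lift-inside sb)) covers
      where
      lift-inside : ∀ {d} → d ⊆ U ─ c → (false ∷ d) ⊆ (true ∷ U)
      lift-inside d⊆U─c = out⊆ (p─q⊆p U c ∘ d⊆U─c)
      c-disjoint : ∀ {d} → d ⊆ U ─ c → Empty ((true ∷ c) ∩ (false ∷ d))
      c-disjoint {d} d⊆U─c (suc i , i∈∩) with x∈p∩q⁻ (true ∷ c) (false ∷ d) i∈∩
      ... | there i∈c , there i∈d = x∈p─q⇒x∉q U c (d⊆U─c i∈d) i∈c
      covers : ∀ i → i ∈ true ∷ U → Any (i ∈_) ((true ∷ c) ∷ liftBlocks D)
      covers zero    _            = here here
      covers (suc i) (there i∈U) with i ∈? c
      ... | yes i∈c = here (there i∈c)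
      ... | no  i∉c = there (Any.map⁺ (Any.map there (cv i (x∈p∧x∉q⇒x∈p─q i∈U i∉c))))

  ¬PartitionOf-uncovered : ∀ {m} {U : Subset m} D → ¬ PartitionOf (true ∷ U) (liftBlocks D)
  ¬PartitionOf-uncovered D P = zero∉liftBlocks D (PartitionOf.covers P zero here)

  ¬PartitionOf-overlap : ∀ {m} {U : Subset (suc m)} {c₁ c₂ rest} →
                         ¬ PartitionOf U ((true ∷ c₁) ∷ (true ∷ c₂) ∷ rest)
  ¬PartitionOf-overlap P with PartitionOf.disjoint P
  ... | (disjoint ∷ _) ∷ _ = disjoint (zero , here)

  ¬PartitionOf-outside : ∀ {m} {U : Subset m} {c rest} → ¬ PartitionOf (false ∷ U) ((true ∷ c) ∷ rest)
  ¬PartitionOf-outside P with PartitionOf.inside P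
  ... | c⊆U ∷ _ with () ← c⊆U here

  Obeys-outside : ∀ {m} {σ : Rules (suc m)} {D : List (Subset m)} →
                  Obeys σ (liftBlocks D) ⇔ (Holds (head σ) Void × Obeys (tail σ) D)
  Obeys-outside {σ = σ} {D} = mk⇔
    (λ obeys → Equivalence.to (Holds-cong (head σ) zero∈⇔Void) (obeys zero) ,
               λ j → Equivalence.to (Holds-cong (σ (suc j)) ∈-liftBlocks) (obeys (suc j)))
    (λ { (h , obeys) zero    → Equivalence.from (Holds-cong (head σ) zero∈⇔Void) h
       ; (h , obeys) (suc j) → Equivalence.from (Holds-cong (σ (suc j)) ∈-liftBlocks) (obeys j) })
    where
    zero∈⇔Void : ⁅ zero ⁆ Mem.∈ liftBlocks D ⇔ Void
    zero∈⇔Void = mk⇔ (inside∉liftBlocks D) λ ()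

  Obeys-inside : ∀ {m} {σ : Rules (suc m)} {c : Subset m} {D} →
                 Obeys σ ((true ∷ c) ∷ liftBlocks D) ⇔ (Holds (head σ) (c ≡ ⊥) × Obeys (tail σ) D)
  Obeys-inside {σ = σ} {c} {D} = mk⇔
    (λ obeys → Equivalence.to (Holds-cong (head σ) zero∈⇔c≡⊥) (obeys zero) ,
               λ j → Equivalence.to (Holds-cong (σ (suc j)) suc∈⇔) (obeys (suc j)))
    (λ { (h , obeys) zero    → Equivalence.from (Holds-cong (head σ) zero∈⇔c≡⊥) h
       ; (h , obeys) (suc j) → Equivalence.from (Holds-cong (σ (suc j)) suc∈⇔) (obeys j) })
    where
    zero∈⇔c≡⊥ : ⁅ zero ⁆ Mem.∈ ((true ∷ c) ∷ liftBlocks D) ⇔ (c ≡ ⊥)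
    zero∈⇔c≡⊥ = mk⇔ (λ { (here refl) → refl ; (there ⊥∈) → ⊥-elim (inside∉liftBlocks D ⊥∈) })
                    (λ { refl → here refl })
    suc∈⇔ : ∀ {j} → ⁅ suc j ⁆ Mem.∈ ((true ∷ c) ∷ liftBlocks D) ⇔ ⁅ j ⁆ Mem.∈ D
    suc∈⇔ = mk⇔ (λ { (there j∈) → Equivalence.to ∈-liftBlocks j∈ })
                (there ∘ Equivalence.from ∈-liftBlocks)

  𝟙-partition-outside : ∀ {m} (U : Subset m) σ D →
    𝟙 (does (partitionObeying? (false ∷ U) σ (liftBlocks D)))
    ≡ weight (head σ) never * 𝟙 (does (partitionObeying? U (tail σ) D))
  𝟙-partition-outside U σ D =
    trans (cong 𝟙 (does-⇔ split (partitionObeying? (false ∷ U) σ (liftBlocks D))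
                                (holds? (head σ) never ×-dec partitionObeying? U (tail σ) D)))
          (𝟙-∧ (does (holds? (head σ) never)) (does (partitionObeying? U (tail σ) D)))
    where
    split : PartitionObeying (false ∷ U) σ (liftBlocks D) ⇔ (Holds (head σ) Void × PartitionObeying U (tail σ) D)
    split = mk⇔ (λ (P , O) → let h , O′ = Equivalence.to Obeys-outside O
                             in h , Equivalence.to PartitionOf-outside P , O′)
                (λ (h , P , O) → Equivalence.from PartitionOf-outside P , Equivalence.from Obeys-outside (h , O))

  𝟙-partition-inside : ∀ {m} (U c : Subset m) σ D →
    𝟙 (does (partitionObeying? (true ∷ U) σ ((true ∷ c) ∷ liftBlocks D)))
    ≡ blockWeight U c (head σ) * 𝟙 (does (partitionObeying? (U ─ c) (tail σ) D))
  𝟙-partition-inside U c σ D =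
    trans (cong 𝟙 (does-⇔ split (partitionObeying? (true ∷ U) σ ((true ∷ c) ∷ liftBlocks D))
                                ((c ⊆? U ×-dec holds? (head σ) (c ≟ˢ ⊥))
                                   ×-dec partitionObeying? (U ─ c) (tail σ) D)))
          (trans (𝟙-∧ (does (c ⊆? U) ∧ does (holds? (head σ) (c ≟ˢ ⊥))) _)
                 (cong (_* 𝟙 (does (partitionObeying? (U ─ c) (tail σ) D))) (𝟙-∧ (does (c ⊆? U)) _)))
    where
    split : PartitionObeying (true ∷ U) σ ((true ∷ c) ∷ liftBlocks D)
            ⇔ ((c ⊆ U × Holds (head σ) (c ≡ ⊥)) × PartitionObeying (U ─ c) (tail σ) D)
    split = mk⇔ (λ (P , O) → let c⊆U , P′ = Equivalence.to PartitionOf-inside P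
                                 h , O′ = Equivalence.to Obeys-inside O
                             in (c⊆U , h) , P′ , O′)
                (λ ((c⊆U , h) , P , O) →
                   Equivalence.from PartitionOf-inside (c⊆U , P) , Equivalence.from Obeys-inside (h , O))

  𝟙-impossible : ∀ {P : Set} (P? : Dec P) → ¬ P → 𝟙 (does P?) ≡ 0
  𝟙-impossible P? ¬P = cong 𝟙 (dec-false P? ¬P)

  -- a block list of Fin (1 + m) splits into the blocks containing 0 and the others
  bruteCount-split : ∀ m (U : Subset (suc m)) σ →
    bruteCount (suc m) U σ ≡ sumOver (sublists (allSubsets m)) (λ A → sumOver (sublists (allSubsets m)) (λ D →
                               𝟙 (does (partitionObeying? U σ (map (true ∷_) A ++ liftBlocks D)))))
  bruteCount-split m U σ =
    trans (sumOver-sublists-++ (map (true ∷_) (allSubsets m)) (liftBlocks (allSubsets m)) _)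
    (trans (sumOver-sublists-map (true ∷_) (allSubsets m) _)
           (sumOver-cong (sublists (allSubsets m)) (λ A → sumOver-sublists-map (false ∷_) (allSubsets m) _)))

  bruteCount≡countParts : ∀ m U σ → bruteCount m U σ ≡ countParts m U σ
  bruteCount≡countParts zero    []          σ =
    cong₂ _+_ (𝟙-impossible (partitionObeying? [] σ ([] ∷ [])) (λ (P , _) → no-block (PartitionOf.nonempty P)))
              (cong (_+ 0) (cong 𝟙 (dec-true (partitionObeying? [] σ []) (mkPartition [] [] [] (λ ()) , λ ()))))
    where no-block : ¬ All Nonempty ([] ∷ [])
          no-block ((() , _) ∷ _)
  bruteCount≡countParts (suc m) (false ∷ U) σ =
    trans (bruteCount-split m (false ∷ U) σ)
    (trans (sumOver-sublists-empty (allSubsets m) _ (λ c A → sumOver-zero (sublists (allSubsets m)) _ (λ D →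
              𝟙-impossible (partitionObeying? (false ∷ U) σ ((true ∷ c) ∷ map (true ∷_) A ++ liftBlocks D))
                           (¬PartitionOf-outside ∘ proj₁))))
    (trans (sumOver-cong (sublists (allSubsets m)) (𝟙-partition-outside U σ))
    (trans (sumOver-* (sublists (allSubsets m)) (weight (head σ) never) _)
           (cong (weight (head σ) never *_) (bruteCount≡countParts m U (tail σ))))))
  bruteCount≡countParts (suc m) (true ∷ U)  σ =
    trans (bruteCount-split m (true ∷ U) σ)
    (trans (sumOver-sublists-singletons (allSubsets m) _
              (sumOver-zero (sublists (allSubsets m)) _ (λ D →
                 𝟙-impossible (partitionObeying? (true ∷ U) σ (liftBlocks D)) (¬PartitionOf-uncovered D ∘ proj₁)))
              (λ a b as → sumOver-zero (sublists (allSubsets m)) _ (λ D →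
                 𝟙-impossible (partitionObeying? (true ∷ U) σ (map (true ∷_) (a ∷ b ∷ as) ++ liftBlocks D))
                              (¬PartitionOf-overlap ∘ proj₁))))
           (sumOver-cong (allSubsets m) block-of-zero))
    where
    block-of-zero : ∀ c →
      sumOver (sublists (allSubsets m))
              (λ D → 𝟙 (does (partitionObeying? (true ∷ U) σ ((true ∷ c) ∷ liftBlocks D))))
      ≡ blockWeight U c (head σ) * countParts m (U ─ c) (tail σ)
    block-of-zero c =
      trans (sumOver-cong (sublists (allSubsets m)) (𝟙-partition-inside U c σ))
      (trans (sumOver-* (sublists (allSubsets m)) (blockWeight U c (head σ)) _)
             (cong (blockWeight U c (head σ) *_) (bruteCount≡countParts m (U ─ c) (tail σ))))

module LargestSingletonCount where

  open import Data.Bool.Base using (true; false)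
  open import Data.Nat.Base as ℕ using (ℕ; zero; suc; _+_; _∸_; _<_; z≤n; s≤s)
  import Data.Nat.Properties as ℕP
  open import Data.Fin.Base using (Fin; zero; suc; toℕ; fromℕ<)
  open import Data.Fin.Properties using (toℕ-injective; toℕ-fromℕ<)
  open import Data.Fin.Subset using (Subset; _-_; ⊤; ⁅_⁆; ∣_∣; _∈_; _∉_; _⊆_)
  open import Data.Fin.Subset.Properties using (∈⊤; ⊆⊤; ∣⊤∣≡n; x∈p∧x≢y⇒x∈p-y)
  open import Data.Vec.Base using ([]; _∷_; there)
  import Data.Vec.Properties as VecP
  import Data.List.Relation.Unary.All as All
  import Data.List.Membership.Propositional as Mem
  open import Data.Product.Base using (_×_; _,_)
  open import Data.Unit.Base using (tt)
  open import Function.Bundles using (_⇔_; mk⇔)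
  open import Relation.Nullary using (_×-dec_)
  open import Relation.Nullary.Decidable using (does-⇔)
  open import Data.Integer.Base as ℤ using (ℤ; -_) renaming (+_ to pos)
  import Data.Integer.Properties as ℤP
  import Data.Integer.Tactic.RingSolver as ℤSolver
  open import Relation.Binary.PropositionalEquality
  open import Defs
  open ShiftOperators using (Seq; E+[_]; E+[_]^[_]; _⊕_; E+^-cong; E+^-⊕; E+^-comm)
  open SingletonRules
  open BruteForce

  maxSingletonRule : ℕ → ℕ → Rule
  maxSingletonRule zero    zero    = required
  maxSingletonRule zero    (suc i) = forbidden
  maxSingletonRule (suc k) zero    = free
  maxSingletonRule (suc k) (suc i) = maxSingletonRule k i

  -- {k} must be a block and no {j} with j > k may be one
  maxSingleton : ℕ → ∀ {m} → Rules m
  maxSingleton k j = maxSingletonRule k (toℕ j)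

  maxSingletonRule-self : ∀ k → maxSingletonRule k k ≡ required
  maxSingletonRule-self zero    = refl
  maxSingletonRule-self (suc k) = maxSingletonRule-self k

  maxSingletonRule-above : ∀ k i → k < i → maxSingletonRule k i ≡ forbidden
  maxSingletonRule-above zero    (suc i) _         = refl
  maxSingletonRule-above (suc k) (suc i) (s≤s k<i) = maxSingletonRule-above k i k<i

  maxSingletonRule-required : ∀ k i → maxSingletonRule k i ≡ required → i ≡ k
  maxSingletonRule-required zero    zero    _    = refl
  maxSingletonRule-required (suc k) (suc i) rule = cong suc (maxSingletonRule-required k i rule)

  maxSingletonRule-forbidden : ∀ k i → maxSingletonRule k i ≡ forbidden → k < i
  maxSingletonRule-forbidden zero    (suc i) _    = s≤s z≤n
  maxSingletonRule-forbidden (suc k) (suc i) rule = s≤s (maxSingletonRule-forbidden k i rule)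

  A≡bruteCount : ∀ n k → k < suc n → A n k ≡ bruteCount (suc n) ⊤ (maxSingleton k)
  A≡bruteCount n k k<1+n =
    trans (length-filter (λ bs → isPartition? bs ×-dec largestSingleton? k bs) (sublists (allSubsets (suc n))))
          (sumOver-cong (sublists (allSubsets (suc n))) (λ bs → cong 𝟙
            (does-⇔ equivalence (isPartition? bs ×-dec largestSingleton? k bs)
                                (partitionObeying? ⊤ (maxSingleton k) bs))))
    where
    equivalence : ∀ {bs} → (IsPartition bs × LargestSingleton k bs) ⇔ PartitionObeying ⊤ (maxSingleton k) bs
    equivalence {bs} = mk⇔ to from
      where
      to : IsPartition bs × LargestSingleton k bs → PartitionObeying ⊤ (maxSingleton k) bs
      to (P , (j₀ , toℕj₀≡k , j₀-singleton) , no-larger) =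
        mkPartition (IsPartition.blocksNonempty P) (IsPartition.pairwiseDisjoint P) (All.tabulate (λ _ → ⊆⊤))
                    (λ i _ → IsPartition.covers P i) ,
        obeys
        where
        obeys : Obeys (maxSingleton k) bs
        obeys j with maxSingletonRule k (toℕ j) in rule
        ... | required  = subst (λ i → ⁅ i ⁆ Mem.∈ bs)
                                (toℕ-injective (trans toℕj₀≡k (sym (maxSingletonRule-required k (toℕ j) rule))))
                                j₀-singleton
        ... | forbidden = no-larger j (maxSingletonRule-forbidden k (toℕ j) rule)
        ... | free      = tt
      from : PartitionObeying ⊤ (maxSingleton k) bs → IsPartition bs × LargestSingleton k bs
      from (mkPartition ne dj _ cv , obeys) =
        record { blocksNonempty = ne ; pairwiseDisjoint = dj ; covers = λ i → cv i ∈⊤ } ,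
        (j₀ , toℕ-fromℕ< k<1+n ,
         subst (λ r → Holds r (⁅ j₀ ⁆ Mem.∈ bs))
               (trans (cong (maxSingletonRule k) (toℕ-fromℕ< k<1+n)) (maxSingletonRule-self k)) (obeys j₀)) ,
        (λ j k<j → subst (λ r → Holds r (⁅ j ⁆ Mem.∈ bs)) (maxSingletonRule-above k (toℕ j) k<j) (obeys j))
        where
        j₀ : Fin (suc n)
        j₀ = fromℕ< k<1+n

  -- the elements j > k
  above : ℕ → ∀ {m} → Subset m
  above k       {zero}  = []
  above zero    {suc m} = false ∷ ⊤
  above (suc k) {suc m} = false ∷ above k

  ∣above∣ : ∀ k m → ∣ above k {m} ∣ ≡ m ∸ suc k
  ∣above∣ k       zero    = refl
  ∣above∣ zero    (suc m) = ∣⊤∣≡n m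
  ∣above∣ (suc k) (suc m) = ∣above∣ k m

  fromℕ<∉above : ∀ {n} k (k<n : k < n) → fromℕ< k<n ∉ above k
  fromℕ<∉above {suc n} zero    _         ()
  fromℕ<∉above {suc n} (suc k) (s≤s k<n) (there k∈) = fromℕ<∉above k k<n k∈

  above⊆⊤-minus : ∀ {n} k (k<n : k < n) → above k ⊆ ⊤ - fromℕ< k<n
  above⊆⊤-minus k k<n {i} i∈above = x∈p∧x≢y⇒x∈p-y ∈⊤ (λ { refl → fromℕ<∉above k k<n i∈above })

  maxSingleton-freed : ∀ {n} k (k<n : k < n) j → (maxSingleton k [ fromℕ< k<n ]≔ free) j ≡ forbid (above k) j
  maxSingleton-freed {suc n} zero    _         zero    = refl
  maxSingleton-freed {suc n} zero    _         (suc j) = cong forbidIf (sym (VecP.lookup-replicate j true))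
  maxSingleton-freed {suc n} (suc k) (s≤s k<n) zero    = refl
  maxSingleton-freed {suc n} (suc k) (s≤s k<n) (suc j) = maxSingleton-freed k k<n j

  A≡avoiding : ∀ t s → pos (A (t + s) t) ≡ avoiding (t + s) s
  A≡avoiding t s = begin
      pos (A n t)
    ≡⟨ cong pos (trans (A≡bruteCount n t t<1+n) (bruteCount≡countParts (suc n) ⊤ (maxSingleton t))) ⟩
      pos (countParts (suc n) ⊤ (maxSingleton t))
    ≡⟨ cong pos (countParts-required (suc n) ⊤ (maxSingleton t) x t-required ∈⊤) ⟩
      pos (countParts (suc n) (⊤ - x) (maxSingleton t [ x ]≔ free))
    ≡⟨ cong pos (countParts-cong (suc n) (⊤ - x) (maxSingleton-freed t t<1+n)) ⟩
      pos (countParts (suc n) (⊤ - x) (forbid (above t)))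
    ≡⟨ countParts-forbid (n ∸ t) (suc n) (⊤ - x) (above t) (above⊆⊤-minus t t<1+n) (∣above∣ t (suc n)) ⟩
      avoiding (∣ ⊤ - x ∣) (n ∸ t)
    ≡⟨ cong₂ avoiding ∣⊤-x∣≡n (ℕP.m+n∸m≡n t s) ⟩
      avoiding n s
    ∎
    where
    open ≡-Reasoning
    n = t + s
    t<1+n : t < suc n
    t<1+n = s≤s (ℕP.m≤m+n t s)
    x : Fin (suc n)
    x = fromℕ< t<1+n
    t-required : maxSingleton t x ≡ required
    t-required = trans (cong (maxSingletonRule t) (toℕ-fromℕ< t<1+n)) (maxSingletonRule-self t)
    ∣⊤-x∣≡n : ∣ ⊤ - x ∣ ≡ n
    ∣⊤-x∣≡n = ℕP.suc-injective (trans (sym (size-minus ⊤ (∈⊤ {x = x}))) (∣⊤∣≡n (suc n)))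

  bellℤ : Seq
  bellℤ i = pos (bell i)

  binomialSum-E+ : ∀ u f → pos (binomialSum u f) ≡ E+[ pos 1 ]^[ u ] (λ j → pos (f j)) 0
  binomialSum-E+ zero    f = refl
  binomialSum-E+ (suc u) f = begin
      pos (binomialSum u f + binomialSum u (λ j → f (suc j)))
    ≡⟨ ℤP.pos-+ (binomialSum u f) _ ⟩
      pos (binomialSum u f) ℤ.+ pos (binomialSum u (λ j → f (suc j)))
    ≡⟨ cong₂ ℤ._+_ (binomialSum-E+ u f) (binomialSum-E+ u (λ j → f (suc j))) ⟩
      E+[ pos 1 ]^[ u ] F 0 ℤ.+ E+[ pos 1 ]^[ u ] (λ j → F (suc j)) 0
    ≡⟨ ℤP.+-comm (E+[ pos 1 ]^[ u ] F 0) _ ⟩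
      E+[ pos 1 ]^[ u ] (λ j → F (suc j)) 0 ℤ.+ E+[ pos 1 ]^[ u ] F 0
    ≡⟨ E+^-⊕ (pos 1) u (λ j → F (suc j)) F 0 ⟨
      E+[ pos 1 ]^[ u ] ((λ j → F (suc j)) ⊕ F) 0
    ≡⟨ E+^-cong (pos 1) u (λ k → cong (λ z → F (suc k) ℤ.+ z) (ℤP.*-identityˡ (F k))) 0 ⟨
      E+[ pos 1 ]^[ u ] (E+[ pos 1 ] F) 0
    ∎
    where
    open ≡-Reasoning
    F : Seq
    F j = pos (f j)

  bellℤ-rec : ∀ i → E+[ pos 1 ]^[ i ] bellℤ 0 ≡ bellℤ (suc i)
  bellℤ-rec i = sym (trans (cong pos (bell-rec i)) (binomialSum-E+ i bell))

  avoiding≡Δ : ∀ s t → avoiding (t + s) s ≡ E+[ - pos 1 ]^[ s ] bellℤ t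
  avoiding≡Δ zero    t = cong bellℤ (ℕP.+-identityʳ t)
  avoiding≡Δ (suc s) t = begin
      avoiding (t + suc s) s ℤ.- avoiding (ℕ.pred (t + suc s)) s
    ≡⟨ cong₂ (λ u v → avoiding u s ℤ.- avoiding v s) (ℕP.+-suc t s) (cong ℕ.pred (ℕP.+-suc t s)) ⟩
      avoiding (suc t + s) s ℤ.- avoiding (t + s) s
    ≡⟨ cong₂ ℤ._-_ (avoiding≡Δ s (suc t)) (avoiding≡Δ s t) ⟩
      Δ s (suc t) ℤ.- Δ s t
    ≡⟨ difference (Δ s (suc t)) (Δ s t) ⟩
      E+[ - pos 1 ] (Δ s) t
    ≡⟨ E+^-comm (- pos 1) (- pos 1) s bellℤ t ⟩
      Δ (suc s) t
    ∎
    where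
    open ≡-Reasoning
    Δ : ℕ → Seq
    Δ s = E+[ - pos 1 ]^[ s ] bellℤ
    difference : ∀ x y → x ℤ.- y ≡ x ℤ.+ (- pos 1) ℤ.* y
    difference = ℤSolver.solve-∀

module Congruence (p : ℕ) where

  open import Data.Nat.Base as ℕ using (zero; suc; _<_)
  import Data.Nat.Properties as ℕP
  open import Data.Integer.Base using (ℤ; +_; +0; _+_; _*_; _-_; -_)
  import Data.Integer.Properties as ℤP
  open import Data.Integer.Divisibility.Signed using (_∣_; divides; ∣m⇒∣-m; ∣m∣n⇒∣m+n; ∣n⇒∣m*n)
  open import Data.Integer.Tactic.RingSolver using (solve-∀)
  open import Relation.Binary.Bundles using (Setoid)
  import Relation.Binary.Reasoning.Setoid as SetoidReasoning
  open import Relation.Nullary using (yes; no)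
  open import Relation.Binary.PropositionalEquality
  open import Function.Base using (_∘_)
  open ShiftOperators

  infix 4 _≡ₚ_ _≈ₚ_

  record _≡ₚ_ (x y : ℤ) : Set where
    constructor mk
    field divides-difference : + p ∣ x - y

  open _≡ₚ_ public

  ≡ₚ-refl : ∀ {x} → x ≡ₚ x
  ≡ₚ-refl {x} = mk (divides +0 (solve x))
    where solve : ∀ x → x - x ≡ +0 * + p
          solve = solve-∀

  ≡⇒≡ₚ : ∀ {x y} → x ≡ y → x ≡ₚ y
  ≡⇒≡ₚ refl = ≡ₚ-refl

  ≡ₚ-sym : ∀ {x y} → x ≡ₚ y → y ≡ₚ x
  ≡ₚ-sym {x} {y} (mk p∣x-y) = mk (subst (+ p ∣_) (solve x y) (∣m⇒∣-m p∣x-y))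
    where solve : ∀ x y → - (x - y) ≡ y - x
          solve = solve-∀

  ≡ₚ-trans : ∀ {x y z} → x ≡ₚ y → y ≡ₚ z → x ≡ₚ z
  ≡ₚ-trans {x} {y} {z} (mk p∣x-y) (mk p∣y-z) =
    mk (subst (+ p ∣_) (solve x y z) (∣m∣n⇒∣m+n p∣x-y p∣y-z))
    where solve : ∀ x y z → (x - y) + (y - z) ≡ x - z
          solve = solve-∀

  ≡ₚ-setoid : Setoid _ _
  ≡ₚ-setoid = record
    { Carrier = ℤ ; _≈_ = _≡ₚ_
    ; isEquivalence = record { refl = ≡ₚ-refl ; sym = ≡ₚ-sym ; trans = ≡ₚ-trans } }

  module ≡ₚ-Reasoning = SetoidReasoning ≡ₚ-setoid

  +-congₚ : ∀ {x y u v} → x ≡ₚ y → u ≡ₚ v → x + u ≡ₚ y + v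
  +-congₚ {x} {y} {u} {v} (mk p∣x-y) (mk p∣u-v) =
    mk (subst (+ p ∣_) (solve x y u v) (∣m∣n⇒∣m+n p∣x-y p∣u-v))
    where solve : ∀ x y u v → (x - y) + (u - v) ≡ (x + u) - (y + v)
          solve = solve-∀

  *-congˡₚ : ∀ s {x y} → x ≡ₚ y → s * x ≡ₚ s * y
  *-congˡₚ s {x} {y} (mk p∣x-y) = mk (subst (+ p ∣_) (solve s x y) (∣n⇒∣m*n s p∣x-y))
    where solve : ∀ s x y → s * (x - y) ≡ s * x - s * y
          solve = solve-∀

  *-congʳₚ : ∀ s {x y} → x ≡ₚ y → x * s ≡ₚ y * s
  *-congʳₚ s {x} {y} x≡y = subst₂ _≡ₚ_ (ℤP.*-comm s x) (ℤP.*-comm s y) (*-congˡₚ s x≡y)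

  -‿congₚ : ∀ {x y} → x ≡ₚ y → - x ≡ₚ - y
  -‿congₚ {x} {y} (mk p∣x-y) = mk (subst (+ p ∣_) (solve x y) (∣m⇒∣-m p∣x-y))
    where solve : ∀ x y → - (x - y) ≡ - x - - y
          solve = solve-∀

  -congₚ : ∀ {x y u v} → x ≡ₚ y → u ≡ₚ v → x - u ≡ₚ y - v
  -congₚ x≡y u≡v = +-congₚ x≡y (-‿congₚ u≡v)

  ∣⇒≡ₚ0 : ∀ {x} → + p ∣ x → x ≡ₚ +0
  ∣⇒≡ₚ0 {x} p∣x = mk (subst (+ p ∣_) (sym (ℤP.+-identityʳ x)) p∣x)

  ≡ₚ0⇒∣ : ∀ {x} → x ≡ₚ +0 → + p ∣ x
  ≡ₚ0⇒∣ {x} (mk p∣x-0) = subst (+ p ∣_) (ℤP.+-identityʳ x) p∣x-0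

  p≡ₚ0 : + p ≡ₚ +0
  p≡ₚ0 = ∣⇒≡ₚ0 (divides (+ 1) (sym (ℤP.*-identityˡ (+ p))))

  ∑<-vanishₚ : ∀ n f → (∀ i → i < n → f i ≡ₚ +0) → ∑< n f ≡ₚ +0
  ∑<-vanishₚ zero    f f≡0 = ≡ₚ-refl
  ∑<-vanishₚ (suc n) f f≡0 =
    +-congₚ (∑<-vanishₚ n f (λ i i<n → f≡0 i (ℕP.m<n⇒m<1+n i<n))) (f≡0 n (ℕP.n<1+n n))

  ∑<-singleₚ : ∀ n f a → a < n → (∀ i → i < n → i ≢ a → f i ≡ₚ +0) → ∑< n f ≡ₚ f a
  ∑<-singleₚ (suc n) f a a<1+n others with a ℕP.≟ n
  ... | yes refl = ≡ₚ-trans (+-congₚ rest≡0 ≡ₚ-refl) (≡⇒≡ₚ (ℤP.+-identityˡ (f a)))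
    where rest≡0 = ∑<-vanishₚ n f (λ i i<n → others i (ℕP.m<n⇒m<1+n i<n) (ℕP.<⇒≢ i<n))
  ... | no a≢n = ≡ₚ-trans (+-congₚ rest≡fa (others n (ℕP.n<1+n n) (a≢n ∘ sym))) (≡⇒≡ₚ (ℤP.+-identityʳ (f a)))
    where rest≡fa = ∑<-singleₚ n f a (ℕP.≤∧≢⇒< (ℕP.≤-pred a<1+n) a≢n)
                                      (λ i i<n → others i (ℕP.m<n⇒m<1+n i<n))

  ∑<-pairₚ : ∀ n f a b → a < b → b < n → (∀ i → i < n → i ≢ a → i ≢ b → f i ≡ₚ +0) →
             ∑< n f ≡ₚ f a + f b
  ∑<-pairₚ (suc n) f a b a<b b<1+n others with b ℕP.≟ n
  ... | yes refl =
    +-congₚ (∑<-singleₚ n f a a<b (λ i i<n i≢a → others i (ℕP.m<n⇒m<1+n i<n) i≢a (ℕP.<⇒≢ i<n))) ≡ₚ-refl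
  ... | no b≢n = ≡ₚ-trans (+-congₚ rest≡fa+fb (others n (ℕP.n<1+n n) (ℕP.<⇒≢ a<n ∘ sym) (b≢n ∘ sym)))
                          (≡⇒≡ₚ (ℤP.+-identityʳ (f a + f b)))
    where
    b<n = ℕP.≤∧≢⇒< (ℕP.≤-pred b<1+n) b≢n
    a<n = ℕP.<-trans a<b b<n
    rest≡fa+fb = ∑<-pairₚ n f a b a<b b<n (λ i i<n → others i (ℕP.m<n⇒m<1+n i<n))

  _≈ₚ_ : Seq → Seq → Set
  a ≈ₚ b = ∀ k → a k ≡ₚ b k

  ≈ₚ-trans : ∀ {a b c} → a ≈ₚ b → b ≈ₚ c → a ≈ₚ c
  ≈ₚ-trans a≈b b≈c k = ≡ₚ-trans (a≈b k) (b≈c k)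

  E+-congₚ : ∀ {c d} → c ≡ₚ d → ∀ {a b} → a ≈ₚ b → E+[ c ] a ≈ₚ E+[ d ] b
  E+-congₚ {c} {d} c≡d {a} {b} a≈b k =
    +-congₚ (a≈b (suc k)) (≡ₚ-trans (*-congˡₚ c (a≈b k)) (*-congʳₚ (b k) c≡d))

  E+^-congₚ : ∀ {c d} → c ≡ₚ d → ∀ n {a b} → a ≈ₚ b → E+[ c ]^[ n ] a ≈ₚ E+[ d ]^[ n ] b
  E+^-congₚ c≡d zero    a≈b = a≈b
  E+^-congₚ c≡d (suc n) a≈b = E+^-congₚ c≡d n (E+-congₚ c≡d a≈b)

  falling-congₚ : ∀ B n {a b} → a ≈ₚ b → falling B n a ≈ₚ falling B n b
  falling-congₚ B zero    a≈b = a≈b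
  falling-congₚ B (suc n) a≈b = E+-congₚ (≡ₚ-refl {B - + n}) (falling-congₚ B n a≈b)

  E+-coeffₚ : ∀ {c d} → c ≡ₚ d → ∀ a → E+[ c ] a ≈ₚ E+[ d ] a
  E+-coeffₚ c≡d a = E+-congₚ c≡d (λ k → ≡ₚ-refl {a k})

  E+^-coeffₚ : ∀ {c d} → c ≡ₚ d → ∀ n a → E+[ c ]^[ n ] a ≈ₚ E+[ d ]^[ n ] a
  E+^-coeffₚ c≡d n a = E+^-congₚ c≡d n (λ k → ≡ₚ-refl {a k})

  repunit : ℕ → ℕ
  repunit zero    = 0
  repunit (suc n) = suc (repunit n ℕ.* p)

module PrimeModulus (p : ℕ) (p-prime : Prime p) where

  open import Data.Nat.Base as ℕ using (zero; suc; _∸_; _<_; _≤_; z≤n; s≤s)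
  import Data.Nat.Properties as ℕP
  import Data.Nat.Divisibility as ℕD
  open import Data.Nat.Combinatorics
    using (_C_; nCn≡1; nC1≡n; nCk≡nC[n∸k]; nCk+nC[k+1]≡[n+1]C[k+1]; k>n⇒nCk≡0)
  open import Data.Nat.Primality using (euclidsLemma; prime⇒nonTrivial)
  import Data.Nat.Tactic.RingSolver as ℕSolver
  open import Data.Integer.Base using (ℤ; +_; +0; -[1+_]; _+_; _*_; _-_; -_; _^_; ∣_∣)
  import Data.Integer.Properties as ℤP
  open import Data.Integer.Divisibility.Signed using (_∣_; ∣ᵤ⇒∣; ∣⇒∣ᵤ; ∣m⇒∣m*n)
  open import Data.Integer.Tactic.RingSolver using (solve-∀)
  open import Data.Empty using (⊥-elim)
  open import Data.Sum using ([_,_]′)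
  open import Function.Base using (_∘_)
  open import Relation.Nullary using (yes; no; contradiction)
  open import Relation.Binary.Definitions using (tri<; tri≈; tri>)
  open import Relation.Binary.PropositionalEquality
  open import Data.Nat.GeneralisedArithmetic using (iterate)
  open ShiftOperators
  open Congruence p

  C-absorb : ∀ n k → suc k ℕ.* (suc n C suc k) ≡ suc n ℕ.* (n C k)
  C-absorb zero    zero    = refl
  C-absorb zero    (suc k) = ℕP.*-zeroʳ (suc (suc k))
  C-absorb (suc n) zero    = trans (ℕP.*-identityˡ _) (trans (nC1≡n (suc (suc n))) (sym (ℕP.*-identityʳ _)))
  C-absorb (suc n) (suc k) = begin
      suc (suc k) ℕ.* (suc (suc n) C suc (suc k))
    ≡⟨ cong (suc (suc k) ℕ.*_) (sym (nCk+nC[k+1]≡[n+1]C[k+1] (suc n) (suc k))) ⟩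
      suc (suc k) ℕ.* (X ℕ.+ Z)
    ≡⟨ expand k X Z ⟩
      X ℕ.+ (suc k ℕ.* X ℕ.+ suc (suc k) ℕ.* Z)
    ≡⟨ cong₂ (λ x y → X ℕ.+ (x ℕ.+ y)) (C-absorb n k) (C-absorb n (suc k)) ⟩
      X ℕ.+ (suc n ℕ.* (n C k) ℕ.+ suc n ℕ.* (n C suc k))
    ≡⟨ cong (X ℕ.+_) (trans (sym (ℕP.*-distribˡ-+ (suc n) (n C k) _))
                            (cong (suc n ℕ.*_) (nCk+nC[k+1]≡[n+1]C[k+1] n k))) ⟩
      X ℕ.+ suc n ℕ.* X
    ∎
    where
    open ≡-Reasoning
    X = suc n C suc k
    Z = suc n C suc (suc k)
    expand : ∀ k x z → suc (suc k) ℕ.* (x ℕ.+ z) ≡ x ℕ.+ (suc k ℕ.* x ℕ.+ suc (suc k) ℕ.* z)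
    expand = ℕSolver.solve-∀

  prime∣C : ∀ {q} → Prime q → ∀ {i} → 0 < i → i < q → q ℕD.∣ q C i
  prime∣C {suc n} q-prime {suc k} _ 1+k<q =
    [ (λ q∣1+k → contradiction (ℕD.∣⇒≤ q∣1+k) (ℕP.<⇒≱ 1+k<q)) , (λ q∣C → q∣C) ]′
      (euclidsLemma (suc k) (suc n C suc k) q-prime
        (ℕD.divides (n C k) (trans (C-absorb n k) (ℕP.*-comm (suc n) (n C k)))))

  1<p : 1 < p
  1<p = ℕ.nonTrivial⇒n>1 p {{prime⇒nonTrivial p-prime}}

  0<p : 0 < p
  0<p = ℕP.<-trans (s≤s z≤n) 1<p

  -- p divides every binomial coefficient of (X + c)ᵖ except the outer two
  E+^p≡E^p+cᵖ : ∀ c a k → E+[ c ]^[ p ] a k ≡ₚ a (p ℕ.+ k) + c ^ p * a k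
  E+^p≡E^p+cᵖ c a k = begin
      E+[ c ]^[ p ] a k
    ≡⟨ binomial-expansion c p a k ⟩
      ∑< (suc p) (λ i → binomialCoeff c p i * E+[ +0 ]^[ i ] a k)
    ≈⟨ ∑<-pairₚ (suc p) _ 0 p 0<p (ℕP.n<1+n p) middle ⟩
      + 1 * c ^ p * a k + + (p C p) * c ^ (p ∸ p) * E+[ +0 ]^[ p ] a k
    ≡⟨ cong₂ (λ x y → + 1 * c ^ p * a k + + x * c ^ y * E+[ +0 ]^[ p ] a k) (nCn≡1 p) (ℕP.n∸n≡0 p) ⟩
      + 1 * c ^ p * a k + + 1 * + 1 * E+[ +0 ]^[ p ] a k
    ≡⟨ cong (λ z → + 1 * c ^ p * a k + + 1 * + 1 * z) (E+[0]^-shift p a k) ⟩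
      + 1 * c ^ p * a k + + 1 * + 1 * a (p ℕ.+ k)
    ≡⟨ simplify (c ^ p) (a k) (a (p ℕ.+ k)) ⟩
      a (p ℕ.+ k) + c ^ p * a k
    ∎
    where
    open ≡ₚ-Reasoning
    simplify : ∀ x y z → + 1 * x * y + + 1 * + 1 * z ≡ z + x * y
    simplify = solve-∀
    middle : ∀ i → i < suc p → i ≢ 0 → i ≢ p → binomialCoeff c p i * E+[ +0 ]^[ i ] a k ≡ₚ +0
    middle zero    _     0≢0 _   = ⊥-elim (0≢0 refl)
    middle (suc i) i<1+p _   i≢p = ∣⇒≡ₚ0 (∣m⇒∣m*n _ (∣m⇒∣m*n _ (∣ᵤ⇒∣ {+ p} {+ (p C suc i)}
      (prime∣C p-prime (s≤s z≤n) (ℕP.≤∧≢⇒< (ℕP.≤-pred i<1+p) i≢p)))))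

  geometric : ℤ → Seq
  geometric t k = t ^ k

  E+^-geometric : ∀ t c n → E+[ c ]^[ n ] (geometric t) ≗ ((t + c) ^ n) ⊙ geometric t
  E+^-geometric t c zero    k = sym (ℤP.*-identityˡ (t ^ k))
  E+^-geometric t c (suc n) k = begin
      E+[ c ]^[ n ] (E+[ c ] (geometric t)) k
    ≡⟨ E+^-cong c n (λ j → sym (ℤP.*-distribʳ-+ (t ^ j) t c)) k ⟩
      E+[ c ]^[ n ] ((t + c) ⊙ geometric t) k
    ≡⟨ E+^-⊙ c n (t + c) (geometric t) k ⟩
      (t + c) * E+[ c ]^[ n ] (geometric t) k
    ≡⟨ cong ((t + c) *_) (E+^-geometric t c n k) ⟩
      (t + c) * ((t + c) ^ n * t ^ k)
    ≡⟨ ℤP.*-assoc (t + c) _ _ ⟨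
      (t + c) ^ suc n * t ^ k
    ∎
    where open ≡-Reasoning

  freshman : ∀ t → (t + + 1) ^ p ≡ₚ t ^ p + + 1
  freshman t = begin
      (t + + 1) ^ p
    ≡⟨ ℤP.*-identityʳ _ ⟨
      (t + + 1) ^ p * t ^ 0
    ≡⟨ E+^-geometric t (+ 1) p 0 ⟨
      E+[ + 1 ]^[ p ] (geometric t) 0
    ≈⟨ E+^p≡E^p+cᵖ (+ 1) (geometric t) 0 ⟩
      t ^ (p ℕ.+ 0) + (+ 1) ^ p * + 1
    ≡⟨ cong₂ (λ e x → t ^ e + x * + 1) (ℕP.+-identityʳ p) (ℤP.^-zeroˡ p) ⟩
      t ^ p + + 1
    ∎
    where open ≡ₚ-Reasoning

  fermat : ∀ t → t ^ p ≡ₚ t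
  fermat t = on-ℤ t
    where
    0^p : +0 ^ p ≡ +0
    0^p with s≤s _ ← 0<p = refl
    up : ∀ t → t ^ p ≡ₚ t → (t + + 1) ^ p ≡ₚ t + + 1
    up t tᵖ≡t = ≡ₚ-trans (freshman t) (+-congₚ tᵖ≡t ≡ₚ-refl)
    down : ∀ t → (t + + 1) ^ p ≡ₚ t + + 1 → t ^ p ≡ₚ t
    down t hyp = subst₂ _≡ₚ_ (cancel (t ^ p)) (cancel t)
                            (-congₚ (≡ₚ-trans (≡ₚ-sym (freshman t)) hyp) (≡ₚ-refl {+ 1}))
      where cancel : ∀ x → x + + 1 - + 1 ≡ x
            cancel = solve-∀
    on-ℕ : ∀ n → (+ n) ^ p ≡ₚ + n
    on-ℕ zero    = ≡⇒≡ₚ 0^p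
    on-ℕ (suc n) = subst (λ z → z ^ p ≡ₚ z) (cong +_ (ℕP.+-comm n 1)) (up (+ n) (on-ℕ n))
    on-neg : ∀ n → (- + n) ^ p ≡ₚ - + n
    on-neg zero    = ≡⇒≡ₚ 0^p
    on-neg (suc n) = down (- + suc n) (subst (λ z → z ^ p ≡ₚ z) (sym (step (+ n))) (on-neg n))
      where step : ∀ x → - (+ 1 + x) + + 1 ≡ - x
            step = solve-∀
    on-ℤ : ∀ t → t ^ p ≡ₚ t
    on-ℤ (+ n)      = on-ℕ n
    on-ℤ -[1+ n ] = on-neg (suc n)

  frobenius : ∀ c a k → E+[ c ]^[ p ] a k ≡ₚ a (p ℕ.+ k) + c * a k
  frobenius c a k =
    ≡ₚ-trans (E+^p≡E^p+cᵖ c a k) (+-congₚ (≡ₚ-refl {a (p ℕ.+ k)}) (*-congʳₚ (a k) (fermat c)))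

  C[1+m,m] : ∀ m → suc m C m ≡ suc m
  C[1+m,m] m =
    trans (nCk≡nC[n∸k] (ℕP.n≤1+n m)) (trans (cong (suc m C_) (ℕP.m+n∸n≡m 1 m)) (nC1≡n (suc m)))

  *-cancel-unitₚ : ∀ x m → 0 < m → m < p → x * + m ≡ₚ +0 → x ≡ₚ +0
  *-cancel-unitₚ x (suc m) _ 1+m<p x*m≡0 = ∣⇒≡ₚ0 (∣ᵤ⇒∣ {+ p} {x}
    ([ (λ p∣x → p∣x) , (λ p∣1+m → contradiction (ℕD.∣⇒≤ p∣1+m) (ℕP.<⇒≱ 1+m<p)) ]′
       (euclidsLemma ∣ x ∣ (suc m) p-prime p∣∣x∣*m)))
    where
    p∣∣x∣*m : p ℕD.∣ ∣ x ∣ ℕ.* suc m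
    p∣∣x∣*m = subst (p ℕD.∣_) (ℤP.abs-* x (+ suc m)) (∣⇒∣ᵤ (≡ₚ0⇒∣ x*m≡0))

  translate-stirling₁-prime : ∀ m → translate p (stirling₁ p) m ≡ₚ stirling₁ p m
  translate-stirling₁-prime m = at (ℕ.pred p) (ℕP.suc-pred p {{ℕ.>-nonZero 0<p}})
    where
    at : ∀ n → suc n ≡ p → translate p (stirling₁ p) m ≡ₚ stirling₁ p m
    at n refl = begin
        translate (suc n) (stirling₁ (suc n)) m
      ≡⟨ translate-stirling₁ n m ⟩
        stirling₁ (suc n) m + + suc n * stirling₁ n m
      ≈⟨ +-congₚ (≡ₚ-refl {stirling₁ (suc n) m}) (*-congʳₚ (stirling₁ n m) p≡ₚ0) ⟩
        stirling₁ (suc n) m + +0 * stirling₁ n m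
      ≡⟨ cong (λ z → stirling₁ (suc n) m + z) (ℤP.*-zeroˡ (stirling₁ n m)) ⟩
        stirling₁ (suc n) m + +0
      ≡⟨ ℤP.+-identityʳ (stirling₁ (suc n) m) ⟩
        stirling₁ (suc n) m
      ∎
      where open ≡ₚ-Reasoning

  stirling₁-prime-zero : stirling₁ p 0 ≡ +0
  stirling₁-prime-zero = at (ℕ.pred p) (ℕP.suc-pred p {{ℕ.>-nonZero 0<p}})
    where
    at : ∀ n → suc n ≡ p → stirling₁ p 0 ≡ +0
    at n refl = stirling₁-zero n

  -- Comparing the coefficients of xᵐ in translate-stirling₁-prime determines stirling₁ p (m + 1)
  -- from the higher coefficients.
  stirling₁-prime-step : ∀ m → 0 < m → suc m < p → (∀ j → suc m < j → j < p → stirling₁ p j ≡ₚ +0) →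
                         stirling₁ p (suc m) ≡ₚ +0
  stirling₁-prime-step m 0<m 1+m<p higher =
    *-cancel-unitₚ (stirling₁ p (suc m)) (suc m) (s≤s z≤n) 1+m<p top-term≡0
    where
    open ≡ₚ-Reasoning
    f : ℕ → ℤ
    f i = stirling₁ p i * + (i C m)
    others : ∀ i → i < suc p → i ≢ m → i ≢ suc m → f i ≡ₚ +0
    others i i<1+p i≢m i≢1+m with ℕP.<-cmp i m
    ... | tri< i<m _ _ = ≡⇒≡ₚ (trans (cong (λ z → stirling₁ p i * + z) (k>n⇒nCk≡0 i<m))
                                     (ℤP.*-zeroʳ (stirling₁ p i)))
    ... | tri≈ _ i≡m _ = ⊥-elim (i≢m i≡m)
    ... | tri> _ _ m<i with i ℕP.≟ p
    ...   | yes refl = ≡ₚ-trans (*-congˡₚ (stirling₁ p p) (∣⇒≡ₚ0 (∣ᵤ⇒∣ p∣C[p,m]))) (≡⇒≡ₚ (ℤP.*-zeroʳ (stirling₁ p p)))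
      where p∣C[p,m] = prime∣C p-prime 0<m (ℕP.<-trans (ℕP.n<1+n m) 1+m<p)
    ...   | no i≢p  = ≡ₚ-trans (*-congʳₚ (+ (i C m)) (higher i 1+m<i i<p)) (≡⇒≡ₚ (ℤP.*-zeroˡ (+ (i C m))))
      where
      1+m<i = ℕP.≤∧≢⇒< m<i (i≢1+m ∘ sym)
      i<p = ℕP.≤∧≢⇒< (ℕP.≤-pred i<1+p) i≢p
    low+top≡low : stirling₁ p m + stirling₁ p (suc m) * + suc m ≡ₚ stirling₁ p m
    low+top≡low = begin
        stirling₁ p m + stirling₁ p (suc m) * + suc m
      ≡⟨ cong₂ (λ x y → x + stirling₁ p (suc m) * + y)
               (sym (trans (cong (λ z → stirling₁ p m * + z) (nCn≡1 m)) (ℤP.*-identityʳ (stirling₁ p m))))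
               (sym (C[1+m,m] m)) ⟩
        f m + f (suc m)
      ≈⟨ ∑<-pairₚ (suc p) f m (suc m) (ℕP.n<1+n m) (ℕP.<-trans 1+m<p (ℕP.n<1+n p)) others ⟨
        translate p (stirling₁ p) m
      ≈⟨ translate-stirling₁-prime m ⟩
        stirling₁ p m
      ∎
    top-term≡0 : stirling₁ p (suc m) * + suc m ≡ₚ +0
    top-term≡0 = subst₂ _≡ₚ_ (cancel (stirling₁ p m) _) (ℤP.+-inverseʳ (stirling₁ p m))
                            (-congₚ low+top≡low (≡ₚ-refl {stirling₁ p m}))
      where cancel : ∀ a b → a + b - a ≡ b
            cancel = solve-∀

  stirling₁-prime-vanish : ∀ i → 2 ≤ i → i < p → stirling₁ p i ≡ₚ +0
  stirling₁-prime-vanish i 2≤i i<p = descend p i 2≤i i<p (ℕP.m≤n+m p i)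
    where
    descend : ∀ d i → 2 ≤ i → i < p → p ≤ i ℕ.+ d → stirling₁ p i ≡ₚ +0
    descend zero    i       _         i<p p≤i+0 = contradiction (subst (p ≤_) (ℕP.+-identityʳ i) p≤i+0) (ℕP.<⇒≱ i<p)
    descend (suc d) (suc m) (s≤s 1≤m) i<p p≤i+d =
      stirling₁-prime-step m 1≤m i<p (λ j 1+m<j j<p →
        descend d j (ℕP.≤-trans (s≤s 1≤m) (ℕP.<⇒≤ 1+m<j)) j<p
          (ℕP.≤-trans p≤i+d (subst (ℕ._≤ j ℕ.+ d) (sym (ℕP.+-suc (suc m) d)) (ℕP.+-monoˡ-≤ d 1+m<j))))

  stirling₁-prime-others : ∀ (g : ℕ → ℤ) i → i < suc p → i ≢ 1 → i ≢ p → stirling₁ p i * g i ≡ₚ +0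
  stirling₁-prime-others g i i<1+p i≢1 i≢p = ≡ₚ-trans (*-congʳₚ (g i) (coefficient i i<1+p i≢1 i≢p)) (≡⇒≡ₚ refl)
    where
    coefficient : ∀ i → i < suc p → i ≢ 1 → i ≢ p → stirling₁ p i ≡ₚ +0
    coefficient zero          _     _   _   = ≡⇒≡ₚ stirling₁-prime-zero
    coefficient (suc zero)    _     1≢1 _   = ⊥-elim (1≢1 refl)
    coefficient (suc (suc i)) i<1+p _   i≢p =
      stirling₁-prime-vanish (suc (suc i)) (s≤s (s≤s z≤n)) (ℕP.≤∧≢⇒< (ℕP.≤-pred i<1+p) i≢p)

  stirling₁-prime-one : stirling₁ p 1 ≡ₚ - + 1
  stirling₁-prime-one =
    subst₂ _≡ₚ_ (cancel (stirling₁ p 1)) (ℤP.+-identityˡ (- + 1)) (-congₚ s₁+1≡0 (≡ₚ-refl {+ 1}))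
    where
    open ≡ₚ-Reasoning
    cancel : ∀ a → a + + 1 - + 1 ≡ a
    cancel = solve-∀
    f : ℕ → ℤ
    f i = stirling₁ p i * + (i C 0)
    s₁+1≡0 : stirling₁ p 1 + + 1 ≡ₚ +0
    s₁+1≡0 = begin
        stirling₁ p 1 + + 1
      ≡⟨ cong₂ _+_ (sym (ℤP.*-identityʳ (stirling₁ p 1))) (cong (_* + 1) (sym (stirling₁-diag p))) ⟩
        f 1 + f p
      ≈⟨ ∑<-pairₚ (suc p) f 1 p 1<p (ℕP.n<1+n p) (stirling₁-prime-others (λ i → + (i C 0))) ⟨
        translate p (stirling₁ p) 0
      ≈⟨ translate-stirling₁-prime 0 ⟩
        stirling₁ p 0
      ≡⟨ stirling₁-prime-zero ⟩
        +0
      ∎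

  falling-prime : ∀ B a k → falling B p a k ≡ₚ E+[ B ]^[ p ] a k - E+[ B ] a k
  falling-prime B a k = begin
      falling B p a k
    ≡⟨ falling-expansion B p a k ⟩
      ∑< (suc p) f
    ≈⟨ ∑<-pairₚ (suc p) f 1 p 1<p (ℕP.n<1+n p) (stirling₁-prime-others D) ⟩
      stirling₁ p 1 * D 1 + stirling₁ p p * D p
    ≈⟨ +-congₚ (*-congʳₚ (D 1) stirling₁-prime-one) (≡⇒≡ₚ (cong (_* D p) (stirling₁-diag p))) ⟩
      - + 1 * D 1 + + 1 * D p
    ≡⟨ rearrange (D 1) (D p) ⟩
      D p - D 1
    ∎
    where
    open ≡ₚ-Reasoning
    D : ℕ → ℤ
    D i = E+[ B ]^[ i ] a k
    f : ℕ → ℤ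
    f i = stirling₁ p i * D i
    rearrange : ∀ x y → - + 1 * x + + 1 * y ≡ y - x
    rearrange = solve-∀

  IsTouchard : Seq → Set
  IsTouchard a = ∀ k → a (p ℕ.+ k) ≡ₚ a (suc k) + a k

  IsTouchard-E+ : ∀ c a → IsTouchard a → IsTouchard (E+[ c ] a)
  IsTouchard-E+ c a touchard k =
    ≡ₚ-trans (+-congₚ (subst (λ i → a i ≡ₚ a (suc (suc k)) + a (suc k)) (ℕP.+-suc p k) (touchard (suc k)))
                      (*-congˡₚ c (touchard k)))
             (≡⇒≡ₚ (regroup (a (suc (suc k))) (a (suc k)) (a k) c))
    where regroup : ∀ x y z c → (x + y) + c * (y + z) ≡ (x + c * y) + (y + c * z)
          regroup = solve-∀

  IsTouchard-E+^ : ∀ c n a → IsTouchard a → IsTouchard (E+[ c ]^[ n ] a)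
  IsTouchard-E+^ c zero    a touchard = touchard
  IsTouchard-E+^ c (suc n) a touchard = IsTouchard-E+^ c n (E+[ c ] a) (IsTouchard-E+ c a touchard)

  -- On Touchard sequences Eᵖ acts as E + 1, hence (E + c)ᵖ ≡ Eᵖ + c acts as E + c + 1.
  E+^p-Touchard : ∀ c {a} → IsTouchard a → E+[ c ]^[ p ] a ≈ₚ E+[ c + + 1 ] a
  E+^p-Touchard c {a} touchard k =
    ≡ₚ-trans (frobenius c a k)
             (≡ₚ-trans (+-congₚ (touchard k) (≡ₚ-refl {c * a k})) (≡⇒≡ₚ (collect (a (suc k)) (a k) c)))
    where collect : ∀ x y c → (x + y) + c * y ≡ x + (c + + 1) * y
          collect = solve-∀

  E+^p^m-Touchard : ∀ c m {a} → IsTouchard a → iterate E+[ c ]^[ p ] a m ≈ₚ E+[ c + + 1 ]^[ m ] a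
  E+^p^m-Touchard c zero    touchard = λ k → ≡ₚ-refl
  E+^p^m-Touchard c (suc m) {a} touchard =
    ≈ₚ-trans (iterate-preserves E+[ c ]^[ p ] _≈ₚ_ (E+^-congₚ (≡ₚ-refl {c}) p) m (E+^p-Touchard c touchard))
             (E+^p^m-Touchard c m (IsTouchard-E+ (c + + 1) a touchard))

  falling-E+ : ∀ B n c a → falling B n (E+[ c ] a) ≗ E+[ c ] (falling B n a)
  falling-E+ B zero    c a k = refl
  falling-E+ B (suc n) c a k =
    trans (E+-cong (B - + n) (falling-E+ B n c a) k) (E+-comm (B - + n) c (falling B n a) k)

  E+^repunit-Touchard : ∀ n c {a} → IsTouchard a → E+[ c ]^[ repunit n ] a ≈ₚ falling (c + + n - + 1) n a
  E+^repunit-Touchard zero    c touchard k = ≡ₚ-refl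
  E+^repunit-Touchard (suc n) c {a} touchard k = begin
      E+[ c ]^[ repunit n ℕ.* p ] (E+[ c ] a) k
    ≡⟨ cong (λ x → x k) (iterate-* E+[ c ] (E+[ c ] a) (repunit n) p) ⟩
      iterate E+[ c ]^[ p ] (E+[ c ] a) (repunit n) k
    ≈⟨ E+^p^m-Touchard c (repunit n) (IsTouchard-E+ c a touchard) k ⟩
      E+[ c + + 1 ]^[ repunit n ] (E+[ c ] a) k
    ≈⟨ E+^repunit-Touchard n (c + + 1) (IsTouchard-E+ c a touchard) k ⟩
      falling ((c + + 1) + + n - + 1) n (E+[ c ] a) k
    ≡⟨ cong (λ B → falling B n (E+[ c ] a) k) (top c (+ n)) ⟩
      falling B n (E+[ c ] a) k
    ≡⟨ falling-E+ B n c a k ⟩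
      E+[ c ] (falling B n a) k
    ≡⟨ cong (λ c → E+[ c ] (falling B n a) k) (bottom c (+ n)) ⟩
      falling B (suc n) a k
    ∎
    where
    open ≡ₚ-Reasoning
    B = c + + suc n - + 1
    top : ∀ c n → (c + + 1) + n - + 1 ≡ c + (+ 1 + n) - + 1
    top = solve-∀
    bottom : ∀ c n → c ≡ c + (+ 1 + n) - + 1 - n
    bottom = solve-∀

  -- For B = c + p - 1 the factors run over all residues, so the product is (E + B)ᵖ - (E + B)
  -- ≡ Eᵖ - E, which is the identity on Touchard sequences.
  E+^repunit-p-Touchard : ∀ c {a} → IsTouchard a → E+[ c ]^[ repunit p ] a ≈ₚ a
  E+^repunit-p-Touchard c {a} touchard k = begin
      E+[ c ]^[ repunit p ] a k
    ≈⟨ E+^repunit-Touchard p c touchard k ⟩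
      falling B p a k
    ≈⟨ falling-prime B a k ⟩
      E+[ B ]^[ p ] a k - E+[ B ] a k
    ≈⟨ -congₚ (frobenius B a k) (≡ₚ-refl {E+[ B ] a k}) ⟩
      (a (p ℕ.+ k) + B * a k) - (a (suc k) + B * a k)
    ≈⟨ -congₚ (+-congₚ (touchard k) (≡ₚ-refl {B * a k})) (≡ₚ-refl {a (suc k) + B * a k}) ⟩
      ((a (suc k) + a k) + B * a k) - (a (suc k) + B * a k)
    ≡⟨ cancel (a (suc k)) (a k) B ⟩
      a k
    ∎
    where
    open ≡ₚ-Reasoning
    B = c + + p - + 1
    cancel : ∀ x y B → ((x + y) + B * y) - (x + B * y) ≡ y
    cancel = solve-∀

module TouchardCongruence (p : ℕ) (p-prime : Prime p)
                          (b : Seq) (bell-rec : ∀ n → E+[ 1ℤ ]^[ n ] b 0 ≡ b (suc n)) where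

  open import Data.Nat.Base as ℕ using (zero)
  import Data.Nat.Properties as ℕP
  open import Data.Integer.Base using (ℤ; +_; +0; _+_; _*_; _-_; -_)
  import Data.Integer.Properties as ℤP
  open import Data.Integer.Tactic.RingSolver using (solve-∀)
  open import Relation.Binary.PropositionalEquality
  open ShiftOperators
  open Congruence p
  open PrimeModulus p p-prime

  -- the binomial transform i ↦ ∑ⱼ C(i, j) a j
  binomialTransform : Seq → Seq
  binomialTransform a i = E+[ + 1 ]^[ i ] a 0

  E+-binomialTransform : ∀ c a → E+[ c ] (binomialTransform a) ≗ binomialTransform (E+[ c + + 1 ] a)
  E+-binomialTransform c a i = sym (begin
      E+[ + 1 ]^[ i ] (E+[ c + + 1 ] a) 0
    ≡⟨ E+^-cong (+ 1) i split 0 ⟩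
      E+[ + 1 ]^[ i ] (E+[ + 1 ] a ⊕ (c ⊙ a)) 0
    ≡⟨ E+^-⊕ (+ 1) i (E+[ + 1 ] a) (c ⊙ a) 0 ⟩
      E+[ + 1 ]^[ suc i ] a 0 + E+[ + 1 ]^[ i ] (c ⊙ a) 0
    ≡⟨ cong (λ z → E+[ + 1 ]^[ suc i ] a 0 + z) (E+^-⊙ (+ 1) i c a 0) ⟩
      binomialTransform a (suc i) + c * binomialTransform a i
    ∎)
    where
    open ≡-Reasoning
    split : E+[ c + + 1 ] a ≗ E+[ + 1 ] a ⊕ (c ⊙ a)
    split k = rearrange (a (suc k)) (a k) c
      where rearrange : ∀ x y c → x + (c + + 1) * y ≡ (x + + 1 * y) + c * y
            rearrange = solve-∀

  E+^-binomialTransform : ∀ n c a → E+[ c ]^[ n ] (binomialTransform a) 0 ≡ E+[ c + + 1 ]^[ n ] a 0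
  E+^-binomialTransform zero    c a = refl
  E+^-binomialTransform (suc n) c a =
    trans (E+^-cong c n (E+-binomialTransform c a) 0) (E+^-binomialTransform n c (E+[ c + + 1 ] a))

  β : ℤ → Seq
  β c n = E+[ c ]^[ n ] b 0

  β-suc : ∀ c → β (c + + 1) ≗ E+[ - c ] (β c)
  β-suc c n = begin
      E+[ c + + 1 ]^[ n ] b 0
    ≡⟨ E+^-binomialTransform n c b ⟨
      E+[ c ]^[ n ] (binomialTransform b) 0
    ≡⟨ E+^-cong c n bell-rec 0 ⟩
      E+[ c ]^[ n ] (λ i → b (suc i)) 0
    ≡⟨ subtract (E+[ c ]^[ n ] (λ i → b (suc i)) 0) (β c n) c ⟨
      (E+[ c ]^[ n ] (λ i → b (suc i)) 0 + c * β c n) + - c * β c n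
    ≡⟨ cong (_+ - c * β c n) (sym (trans (E+^-⊕ c n (λ i → b (suc i)) (c ⊙ b) 0)
                                          (cong (λ z → E+[ c ]^[ n ] (λ i → b (suc i)) 0 + z) (E+^-⊙ c n c b 0)))) ⟩
      β c (suc n) + - c * β c n
    ∎
    where
    open ≡-Reasoning
    subtract : ∀ x y c → (x + c * y) + - c * y ≡ x
    subtract = solve-∀

  β-+ : ∀ d n → β (d + + n) ≗ falling (- d) n (β d)
  β-+ d zero    k = cong (λ c → β c k) (ℤP.+-identityʳ d)
  β-+ d (suc n) k = begin
      β (d + + suc n) k
    ≡⟨ cong (λ c → β c k) (shift d (+ n)) ⟩
      β ((d + + n) + + 1) k
    ≡⟨ β-suc (d + + n) k ⟩
      E+[ - (d + + n) ] (β (d + + n)) k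
    ≡⟨ cong (λ c → E+[ c ] (β (d + + n)) k) (negate d (+ n)) ⟩
      E+[ - d - + n ] (β (d + + n)) k
    ≡⟨ E+-cong (- d - + n) (β-+ d n) k ⟩
      falling (- d) (suc n) (β d) k
    ∎
    where
    open ≡-Reasoning
    shift : ∀ d n → d + (+ 1 + n) ≡ (d + n) + + 1
    shift = solve-∀
    negate : ∀ d n → - (d + n) ≡ - d - n
    negate = solve-∀

  β0≡b : β +0 ≗ b
  β0≡b n = trans (E+[0]^-shift n b 0) (cong b (ℕP.+-identityʳ n))

  touchard : IsTouchard b
  touchard k = ≡ₚ-sym (≡ₚ-trans (+-congₚ (≡ₚ-refl {b (suc k)}) bk≡) (≡⇒≡ₚ (cancel (b (p ℕ.+ k)) (b (suc k)))))
    where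
    open ≡ₚ-Reasoning
    cancel : ∀ x y → y + (x - y) ≡ x
    cancel = solve-∀
    β[-p]≡b : β (- + p) ≈ₚ b
    β[-p]≡b n = ≡ₚ-trans (E+^-coeffₚ (-‿congₚ p≡ₚ0) n b 0) (≡⇒≡ₚ (β0≡b n))
    bk≡ : b k ≡ₚ b (p ℕ.+ k) - b (suc k)
    bk≡ = begin
        b k
      ≡⟨ β0≡b k ⟨
        β +0 k
      ≡⟨ cong (λ c → β c k) (sym (ℤP.+-inverseˡ (+ p))) ⟩
        β (- + p + + p) k
      ≡⟨ β-+ (- + p) p k ⟩
        falling (- - + p) p (β (- + p)) k
      ≡⟨ cong (λ B → falling B p (β (- + p)) k) (ℤP.neg-involutive (+ p)) ⟩
        falling (+ p) p (β (- + p)) k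
      ≈⟨ falling-congₚ (+ p) p β[-p]≡b k ⟩
        falling (+ p) p b k
      ≈⟨ falling-prime (+ p) b k ⟩
        E+[ + p ]^[ p ] b k - E+[ + p ] b k
      ≈⟨ -congₚ (E+^-coeffₚ p≡ₚ0 p b k) (E+-coeffₚ p≡ₚ0 b k) ⟩
        E+[ +0 ]^[ p ] b k - E+[ +0 ] b k
      ≡⟨ cong₂ _-_ (E+[0]^-shift p b k) (ℤP.+-identityʳ (b (suc k))) ⟩
        b (p ℕ.+ k) - b (suc k)
      ∎

  Δ : ℕ → Seq
  Δ n = E+[ - + 1 ]^[ n ] b

  Δ-periodic : ∀ n k → Δ n (repunit p ℕ.+ k) ≡ₚ Δ n k
  Δ-periodic n k =
    ≡ₚ-trans (≡⇒≡ₚ (sym (E+[0]^-shift (repunit p) (Δ n) k)))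
             (E+^repunit-p-Touchard +0 (IsTouchard-E+^ (- + 1) n b touchard) k)

  Δ-order-periodic : ∀ n k → Δ (n ℕ.+ repunit p) k ≡ₚ Δ n k
  Δ-order-periodic n k =
    ≡ₚ-trans (≡⇒≡ₚ (cong (λ a → a k) (iterate-+ E+[ - + 1 ] b n (repunit p))))
             (E+^repunit-p-Touchard (- + 1) (IsTouchard-E+^ (- + 1) n b touchard) k)

open import Data.Nat.Base as ℕ using (zero; _+_; _∸_; _^_)
import Data.Nat.Properties as ℕP
open import Data.Nat.DivMod using (_/_; m*n/n≡m)
import Data.Nat.Tactic.RingSolver as ℕSolver
open import Data.Integer.Base using (+_; _-_; -_)
open import Data.Integer.Divisibility using (_∣_)
open import Data.Integer.Divisibility.Signed using (∣⇒∣ᵤ)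
open import Data.Product.Base using (_×_; _,_)
open import Relation.Binary.PropositionalEquality
open import Function.Base using (_∘_)
open import Defs
open ShiftOperators using (E+[_]^[_])
open LargestSingletonCount using (bellℤ; bellℤ-rec; A≡avoiding; avoiding≡Δ)

repunit≡Np : ∀ q → Congruence.repunit (suc (suc q)) (suc (suc q)) ≡ Np (suc (suc q))
repunit≡Np q = sym (begin
    (p ^ p ∸ 1) / suc q
  ≡⟨ cong (λ x → (x ∸ 1) / suc q) (geometric-sum p) ⟨
    (repunit p ℕ.* suc q + 1 ∸ 1) / suc q
  ≡⟨ cong (_/ suc q) (ℕP.m+n∸n≡m (repunit p ℕ.* suc q) 1) ⟩
    (repunit p ℕ.* suc q) / suc q
  ≡⟨ m*n/n≡m (repunit p) (suc q) ⟩
    repunit p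
  ∎)
  where
  open ≡-Reasoning
  p = suc (suc q)
  open Congruence p using (repunit)
  step : ∀ r q → suc (r ℕ.* suc (suc q)) ℕ.* suc q + 1 ≡ suc (suc q) ℕ.* (r ℕ.* suc q + 1)
  step = ℕSolver.solve-∀
  geometric-sum : ∀ n → repunit n ℕ.* suc q + 1 ≡ p ^ n
  geometric-sum zero    = refl
  geometric-sum (suc n) = trans (step (repunit n) q) (cong (p ℕ.*_) (geometric-sum n))

A≡Δ : ∀ n k → + A (n + k) k ≡ E+[ - + 1 ]^[ n ] bellℤ k
A≡Δ n k = trans (cong (λ m → + A m k) (ℕP.+-comm n k)) (trans (A≡avoiding k n) (avoiding≡Δ n k))

theorem4p4 : (p : ℕ) → Prime p → (n k : ℕ) →
    ((+ p) ∣ (+ A (n + Np p + k) k - + A (n + k) k))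
    × ((+ p) ∣ (+ A (n + Np p + k) (Np p + k) - + A (n + k) k))
theorem4p4 (suc (suc q)) p-prime n k rewrite sym (repunit≡Np q) =
  ≡ₚ⇒∣ (begin
    + A (n + N + k) k          ≡⟨ A≡Δ (n + N) k ⟩
    Δ (n + N) k                ≈⟨ Δ-order-periodic n k ⟩
    Δ n k                      ≡⟨ A≡Δ n k ⟨
    + A (n + k) k              ∎) ,
  ≡ₚ⇒∣ (begin
    + A (n + N + k) (N + k)    ≡⟨ cong (λ m → + A m (N + k)) (ℕP.+-assoc n N k) ⟩
    + A (n + (N + k)) (N + k)  ≡⟨ A≡Δ n (N + k) ⟩
    Δ n (N + k)                ≈⟨ Δ-periodic n k ⟩
    Δ n k                      ≡⟨ A≡Δ n k ⟨
    + A (n + k) k              ∎)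
  where
  p = suc (suc q)
  open Congruence p using (_≡ₚ_; divides-difference; repunit; module ≡ₚ-Reasoning)
  open ≡ₚ-Reasoning
  open TouchardCongruence p p-prime bellℤ bellℤ-rec using (Δ; Δ-order-periodic; Δ-periodic)
  N = repunit p
  ≡ₚ⇒∣ : ∀ {x y} → x ≡ₚ y → + p ∣ x - y
  ≡ₚ⇒∣ = ∣⇒∣ᵤ ∘ divides-difference
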